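{- Let $p$ be a prime and $s\ge1$, $n\ge2$ integers. Then \[ \tilde E(n\times 2,p^s,p^j)=\begin{cases}\varphi_n(p^s)\varphi_{n-1}(p^s)\,p^s, & j=0,\\ \varphi_n(p^s)\varphi_{n-1}(p^{s-j})(p^s+p^{s-1}), & 1\le j\le s,\\ 0, & j>s.\end{cases} \]
   Context: $\mathbb{Z}_{p^s}$ is the ring of integers modulo $p^s$. A matrix over $\mathbb{Z}_{p^s}$ is relatively prime if at least one entry is invertible modulo $p^s$ (not divisible by $p$). $\tilde E(n\times m,p^s,p^j)$ is the number of relatively prime $n\times m$ matrices $A$ over $\mathbb{Z}_{p^s}$ such that $Ax\equiv0\pmod{p^s}$ has exactly $p^j$ solutions $x\in\mathbb{Z}_{p^s}^m$. For positive integers $u,c$, $\varphi_u(c)$ is the number of $u$-tuples $(a_1,\dots,a_u)$ with $1\le a_i\le c$ such that at least one $a_i$ is relatively prime to $c$. -}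

module Defs where

open import Data.Nat using (ℕ; zero; suc; _+_; _*_)
open import Data.Nat.Divisibility using (_∣_; _∣?_)
open import Data.Nat.Coprimality using (Coprime; coprime?)
open import Data.Fin using (Fin; toℕ)
open import Data.List using (List; []; _∷_; map; concatMap; allFin; filter; length)
open import Data.Vec using (Vec; []; _∷_; zipWith; foldr)
open import Data.Vec.Relation.Unary.Any as VAny using (Any)
open import Data.Vec.Relation.Unary.All as VAll using (All)
open import Data.Nat using (_≟_)
open import Relation.Nullary using (Dec)
open import Relation.Binary.PropositionalEquality using (_≡_)

tuples : (k q : ℕ) → List (Vec (Fin q) k)
tuples zero    q = [] ∷ []
tuples (suc k) q = concatMap (λ a → map (a ∷_) (tuples k q)) (allFin q)

Matrix : (n m q : ℕ) → Set
Matrix n m q = Vec (Vec (Fin q) m) n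

allMatrices : (n m q : ℕ) → List (Matrix n m q)
allMatrices zero    m q = [] ∷ []
allMatrices (suc n) m q =
  concatMap (λ r → map (r ∷_) (allMatrices n m q)) (tuples m q)

Invertible : {q : ℕ} → Fin q → Set
Invertible {q} a = Coprime (toℕ a) q

RelPrime : {n m q : ℕ} → Matrix n m q → Set
RelPrime A = Any (λ row → Any Invertible row) A

relPrime? : {n m q : ℕ} → (A : Matrix n m q) → Dec (RelPrime A)
relPrime? {q = q} A = VAny.any? (λ row → VAny.any? (λ a → coprime? (toℕ a) q) row) A

-- dot product of two vectors, computed in ℕ (reduction mod q done by divisibility)
dot : {m q : ℕ} → Vec (Fin q) m → Vec (Fin q) m → ℕ
dot r x = foldr _ _+_ 0 (zipWith (λ a b → toℕ a * toℕ b) r x)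

IsSolution : {n m q : ℕ} → Matrix n m q → Vec (Fin q) m → Set
IsSolution {q = q} A x = All (λ row → q ∣ dot row x) A

isSolution? : {n m q : ℕ} → (A : Matrix n m q) → (x : Vec (Fin q) m) → Dec (IsSolution A x)
isSolution? {q = q} A x = VAll.all? (λ row → q ∣? dot row x) A

numSolutions : {n m q : ℕ} → Matrix n m q → ℕ
numSolutions {n} {m} {q} A = length (filter (isSolution? A) (tuples m q))

Etilde : (n m q N : ℕ) → ℕ
Etilde n m q N =
  length (filter (λ A → numSolutions A ≟ N)
           (filter relPrime? (allMatrices n m q)))

-- φ_u(c): number of u-tuples (a_1,…,a_u), 1 ≤ a_i ≤ c, with some a_i coprime to c.
-- A tuple entry i : Fin c represents a_i = toℕ i + 1.
phi : (u c : ℕ) → ℕ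
phi u c = length (filter (λ t → VAny.any? (λ i → coprime? (suc (toℕ i)) c) t) (tuples u c))

-- Split an n × 2 matrix over ℤ/p^s into its columns (u, v). It is relatively prime iff u has a unit
-- entry, or else all entries of u are divisible by p and v has a unit entry. If uᵢ is a unit, the shear
-- (c, w) ↦ c u + w (w padded with 0 at position i) is a bijection ℤ/p^s × (ℤ/p^s)^(n-1) ≅ (ℤ/p^s)^n
-- that turns A x ≡ 0 into x₁ ≡ -c x₂ together with w x₂ ≡ 0; so A has as many solutions as w has
-- annihilators, and the image is divisible by p iff c and w are. Pivoting on v instead treats the second
-- case, with p^(s-1) choices of c in place of p^s. Finally w has p^j annihilators exactly when p^j is the
-- largest power of p (up to p^s) dividing all its entries, and there are φ_{n-1}(p^(s-j)) such w: the
-- vectors divisible by p^j, less those divisible by p^(j+1).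

module Submission where

open import Defs
open import Data.Nat using (ℕ; _+_; _*_; _∸_; _^_; _≤_; _<_)
open import Data.Nat.Primality using (Prime)
open import Data.Product using (_×_)
open import Relation.Binary.PropositionalEquality using (_≡_)

open import Level using (Level; 0ℓ)
open import Data.Nat
  using (zero; suc; pred; _%_; _≟_; _<?_; z≤n; s≤s; s≤s⁻¹; NonZero; ≢-nonZero⁻¹; >-nonZero⁻¹; nonTrivial⇒≢1; nonTrivial⇒n>1)
open import Data.Nat.Properties hiding (_≟_)
open import Data.Nat.Primality using (prime⇒nonZero; prime⇒irreducible; prime⇒nonTrivial)
open import Data.Nat.Tactic.RingSolver using (solve-∀)
open import Data.Nat.DivMod using (%-distribˡ-+; %-distribˡ-*; m%n%n≡m%n; m%n<n; m<n⇒m%n≡m)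
open import Data.Nat.Coprimality using (Coprime; coprime?; coprime-Bézout; coprime-divisor)
import Data.Nat.Coprimality as Coprimality
open import Data.Nat.GCD using (module Bézout)
open import Data.Nat.Divisibility
  using (_∣_; _∣?_; divides; ∣-refl; ∣-trans; _∣0; 1∣_; ∣1⇒≡1; m∣m*n; n∣m*n; ∣m⇒∣m*n; ∣m+n∣m⇒∣n; ∣m∣n⇒∣m+n; ∣⇒≤;
         *-pres-∣; *-cancelˡ-∣; n∣m⇒m%n≡0; m%n≡0⇒n∣m; ∣n∣m%n⇒∣m; %-presˡ-∣)
open import Data.Empty using (⊥-elim)
open import Data.Unit using (⊤; tt)
open import Data.Fin using (Fin; toℕ; fromℕ; fromℕ<; combine; remQuot) renaming (zero to fzero; suc to fsuc)
import Data.Fin.Properties as Finₚ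
open Finₚ using () renaming (_≟_ to _≟ᶠ_)
open import Data.List using (List; []; _∷_; map; concatMap; filter; length; _++_; allFin; cartesianProduct)
import Data.List.Properties as Listₚ
open import Data.Vec using (Vec; []; _∷_; lookup; tabulate; zipWith; insertAt; removeAt)
import Data.Vec.Properties as Vecₚ
open import Data.Vec.Relation.Unary.All.Properties using (lookup⁺; lookup⁻)
open import Data.Vec.Relation.Unary.Any.Properties using (lookup-index)
open import Data.Vec.Relation.Unary.All as All using (All; []; _∷_)
open import Data.Vec.Relation.Unary.Any as Any using (Any; here; there)
open import Data.Product using (Σ; _,_; proj₁; proj₂; uncurry)
import Data.Product.Properties as Productₚ
open import Function using (_∘_; _↔_; mk↔ₛ′; Inverse; _⇔_; mk⇔; Equivalence)
open import Relation.Nullary using (Dec; yes; no; ¬_)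
open import Data.Sum using (_⊎_; inj₁; inj₂; [_,_])
open import Relation.Nullary.Decidable using (¬?; _×-dec_; _→-dec_)
open import Relation.Unary using (Pred; Decidable)
open import Relation.Binary using (tri<; tri≈; tri>; DecidableEquality; IsEquivalence; Setoid)
import Relation.Binary.Reasoning.Setoid as SetoidReasoning
open import Relation.Binary.PropositionalEquality using (refl; sym; trans; cong; cong₂; subst; subst₂; module ≡-Reasoning)

private variable
  ℓ ℓ′ ℓ″ : Level
  A B : Set

-- Finite sums

𝟙 : {X : Set ℓ} → Dec X → ℕ
𝟙 (yes _) = 1
𝟙 (no _)  = 0

𝟙-⇔ : {X : Set ℓ} {Y : Set ℓ′} → (X → Y) → (Y → X) → (d : Dec X) (e : Dec Y) → 𝟙 d ≡ 𝟙 e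
𝟙-⇔ f g (yes x) (yes y) = refl
𝟙-⇔ f g (yes x) (no ¬y) = ⊥-elim (¬y (f x))
𝟙-⇔ f g (no ¬x) (yes y) = ⊥-elim (¬x (g y))
𝟙-⇔ f g (no _)  (no _)  = refl

𝟙-yes : {X : Set ℓ} → X → (d : Dec X) → 𝟙 d ≡ 1
𝟙-yes x d = 𝟙-⇔ (λ _ → x) (λ _ → x) d (yes x)

𝟙-no : {X : Set ℓ} → ¬ X → (d : Dec X) → 𝟙 d ≡ 0
𝟙-no ¬x d = 𝟙-⇔ ¬x (λ ()) d (no (λ ()))

𝟙-× : {X : Set ℓ} {Y : Set ℓ′} {Z : Set ℓ″} (d : Dec X) (e : Dec Y) (h : Dec Z) →
      (Z → X × Y) → (X → Y → Z) → 𝟙 h ≡ 𝟙 d * 𝟙 e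
𝟙-× (yes x) (yes y) h f g = 𝟙-yes (g x y) h
𝟙-× (yes x) (no ¬y) h f g = 𝟙-no (¬y ∘ proj₂ ∘ f) h
𝟙-× (no ¬x) e       h f g = 𝟙-no (¬x ∘ proj₁ ∘ f) h

𝟙-¬? : {X : Set ℓ} (d : Dec X) → 𝟙 d + 𝟙 (¬? d) ≡ 1
𝟙-¬? (yes _) = refl
𝟙-¬? (no _)  = refl

∑ : List A → (A → ℕ) → ℕ
∑ []       f = 0
∑ (x ∷ xs) f = f x + ∑ xs f

syntax ∑ xs (λ x → f) = ∑[ x ∈ xs ] f

∑-cong : (xs : List A) {f g : A → ℕ} → (∀ x → f x ≡ g x) → ∑ xs f ≡ ∑ xs g
∑-cong []       e = refl
∑-cong (x ∷ xs) e = cong₂ _+_ (e x) (∑-cong xs e)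

∑-+ : (xs : List A) (f g : A → ℕ) → ∑[ x ∈ xs ] (f x + g x) ≡ ∑ xs f + ∑ xs g
∑-+ []       f g = refl
∑-+ (x ∷ xs) f g rewrite ∑-+ xs f g = lemma (f x) (g x) (∑ xs f) (∑ xs g)
  where
  lemma : ∀ a b c d → a + b + (c + d) ≡ a + c + (b + d)
  lemma = solve-∀

∑-*ˡ : (xs : List A) (k : ℕ) (f : A → ℕ) → ∑[ x ∈ xs ] (k * f x) ≡ k * ∑ xs f
∑-*ˡ []       k f = sym (*-zeroʳ k)
∑-*ˡ (x ∷ xs) k f rewrite ∑-*ˡ xs k f = sym (*-distribˡ-+ k (f x) (∑ xs f))

∑-*ʳ : (xs : List A) (k : ℕ) (f : A → ℕ) → ∑[ x ∈ xs ] (f x * k) ≡ ∑ xs f * k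
∑-*ʳ xs k f = trans (∑-cong xs (λ x → *-comm (f x) k)) (trans (∑-*ˡ xs k f) (*-comm k (∑ xs f)))

∑-const : (xs : List A) (k : ℕ) → ∑[ x ∈ xs ] k ≡ length xs * k
∑-const []       k = refl
∑-const (x ∷ xs) k = cong (k +_) (∑-const xs k)

∑-++ : (xs ys : List A) (f : A → ℕ) → ∑ (xs ++ ys) f ≡ ∑ xs f + ∑ ys f
∑-++ []       ys f = refl
∑-++ (x ∷ xs) ys f rewrite ∑-++ xs ys f = sym (+-assoc (f x) (∑ xs f) (∑ ys f))

∑-map : (g : A → B) (xs : List A) (f : B → ℕ) → ∑ (map g xs) f ≡ ∑[ x ∈ xs ] f (g x)
∑-map g []       f = refl
∑-map g (x ∷ xs) f = cong (f (g x) +_) (∑-map g xs f)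

∑-concatMap : (g : A → List B) (xs : List A) (f : B → ℕ) →
              ∑ (concatMap g xs) f ≡ ∑[ x ∈ xs ] ∑ (g x) f
∑-concatMap g []       f = refl
∑-concatMap g (x ∷ xs) f = trans (∑-++ (g x) (concatMap g xs) f) (cong (∑ (g x) f +_) (∑-concatMap g xs f))

∑-cartesianProduct : (xs : List A) (ys : List B) (f : A × B → ℕ) →
                     ∑ (cartesianProduct xs ys) f ≡ ∑[ x ∈ xs ] ∑[ y ∈ ys ] f (x , y)
∑-cartesianProduct []       ys f = refl
∑-cartesianProduct (x ∷ xs) ys f =
  trans (∑-++ (map (x ,_) ys) _ f) (cong₂ _+_ (∑-map (x ,_) ys f) (∑-cartesianProduct xs ys f))

∑-zero : (xs : List A) → ∑[ x ∈ xs ] 0 ≡ 0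
∑-zero xs = trans (∑-const xs 0) (*-zeroʳ (length xs))

∑-swap : (xs : List A) (ys : List B) (f : A → B → ℕ) →
         ∑[ x ∈ xs ] ∑[ y ∈ ys ] f x y ≡ ∑[ y ∈ ys ] ∑[ x ∈ xs ] f x y
∑-swap []       ys f = sym (∑-zero ys)
∑-swap (x ∷ xs) ys f rewrite ∑-swap xs ys f = sym (∑-+ ys (f x) _)

length-filter : {P : Pred A ℓ} (P? : Decidable P) (xs : List A) →
                length (filter P? xs) ≡ ∑[ x ∈ xs ] 𝟙 (P? x)
length-filter P? []       = refl
length-filter P? (x ∷ xs) with P? x
... | yes _ = cong suc (length-filter P? xs)
... | no _  = length-filter P? xs

∑-filter : {P : Pred A ℓ} (P? : Decidable P) (xs : List A) (f : A → ℕ) →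
           ∑ (filter P? xs) f ≡ ∑[ x ∈ xs ] (𝟙 (P? x) * f x)
∑-filter P? []       f = refl
∑-filter P? (x ∷ xs) f with P? x
... | yes _ = cong₂ _+_ (sym (+-identityʳ (f x))) (∑-filter P? xs f)
... | no _  = ∑-filter P? xs f

∑-¬? : (xs : List A) {P : Pred A ℓ} (P? : Decidable P) →
       ∑[ x ∈ xs ] 𝟙 (P? x) + ∑[ x ∈ xs ] 𝟙 (¬? (P? x)) ≡ length xs
∑-¬? xs P? = begin
  ∑[ x ∈ xs ] 𝟙 (P? x) + ∑[ x ∈ xs ] 𝟙 (¬? (P? x)) ≡⟨ ∑-+ xs _ _ ⟨
  ∑[ x ∈ xs ] (𝟙 (P? x) + 𝟙 (¬? (P? x)))          ≡⟨ ∑-cong xs (λ x → 𝟙-¬? (P? x)) ⟩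
  ∑[ x ∈ xs ] 1                                   ≡⟨ ∑-const xs 1 ⟩
  length xs * 1                                   ≡⟨ *-identityʳ _ ⟩
  length xs                                       ∎
  where open ≡-Reasoning

-- Lists enumerating every element exactly once

record EnumeratesOnce (_≟_ : DecidableEquality A) (xs : List A) : Set where
  constructor enumeratesOnce
  field occursOnce : ∀ a → ∑[ x ∈ xs ] 𝟙 (x ≟ a) ≡ 1
open EnumeratesOnce

∑-select : {_≟_ : DecidableEquality A} {xs : List A} → EnumeratesOnce _≟_ xs →
           (f : A → ℕ) (a : A) → ∑[ x ∈ xs ] (𝟙 (x ≟ a) * f x) ≡ f a
∑-select {_≟_ = _≟_} {xs} once f a = begin
  ∑[ x ∈ xs ] (𝟙 (x ≟ a) * f x) ≡⟨ ∑-cong xs at-a ⟩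
  ∑[ x ∈ xs ] (𝟙 (x ≟ a) * f a) ≡⟨ ∑-*ʳ xs (f a) _ ⟩
  ∑[ x ∈ xs ] 𝟙 (x ≟ a) * f a   ≡⟨ cong (_* f a) (occursOnce once a) ⟩
  1 * f a                       ≡⟨ *-identityˡ (f a) ⟩
  f a                           ∎
  where
  open ≡-Reasoning
  at-a : ∀ x → 𝟙 (x ≟ a) * f x ≡ 𝟙 (x ≟ a) * f a
  at-a x with x ≟ a
  ... | yes refl = refl
  ... | no _     = refl

∑-reindex : {_≟A_ : DecidableEquality A} {_≟B_ : DecidableEquality B} {xs : List A} {ys : List B} →
            EnumeratesOnce _≟A_ xs → EnumeratesOnce _≟B_ ys →
            (e : A ↔ B) (f : B → ℕ) → ∑ ys f ≡ ∑[ x ∈ xs ] f (Inverse.to e x)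
∑-reindex {_≟A_ = _≟A_} {_≟B_} {xs} {ys} onceA onceB e f = begin
  ∑ ys f                                           ≡⟨ ∑-cong ys (λ y → trans (cong (_* f y) (once-fibre y)) (*-identityˡ (f y))) ⟨
  ∑[ y ∈ ys ] (∑[ x ∈ xs ] 𝟙 (y ≟B to x) * f y)    ≡⟨ ∑-cong ys (λ y → ∑-*ʳ xs (f y) _) ⟨
  ∑[ y ∈ ys ] ∑[ x ∈ xs ] (𝟙 (y ≟B to x) * f y)    ≡⟨ ∑-swap xs ys _ ⟨
  ∑[ x ∈ xs ] ∑[ y ∈ ys ] (𝟙 (y ≟B to x) * f y)    ≡⟨ ∑-cong xs (λ x → ∑-select onceB f (to x)) ⟩
  ∑[ x ∈ xs ] f (to x)                             ∎
  where
  open ≡-Reasoning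
  open Inverse e using (to; from; strictlyInverseˡ; strictlyInverseʳ)
  once-fibre : ∀ y → ∑[ x ∈ xs ] 𝟙 (y ≟B to x) ≡ 1
  once-fibre y = trans (∑-cong xs (λ x → 𝟙-⇔ (λ y≡ → trans (sym (strictlyInverseʳ x)) (cong from (sym y≡)))
                                              (λ x≡ → trans (sym (strictlyInverseˡ y)) (cong to (sym x≡)))
                                              (y ≟B to x) (x ≟A from y)))
                       (occursOnce onceA (from y))

allFin-enumeratesOnce : (n : ℕ) → EnumeratesOnce _≟ᶠ_ (allFin n)
allFin-enumeratesOnce zero    .occursOnce ()
allFin-enumeratesOnce (suc n) .occursOnce i = begin
  ∑[ j ∈ allFin (suc n) ] 𝟙 (j ≟ᶠ i)
    ≡⟨ cong (λ l → ∑[ j ∈ fzero ∷ l ] 𝟙 (j ≟ᶠ i)) (Listₚ.map-tabulate {n = n} (λ j → j) fsuc) ⟨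
  𝟙 (fzero ≟ᶠ i) + ∑ (map fsuc (allFin n)) (λ j → 𝟙 (j ≟ᶠ i))
    ≡⟨ cong (𝟙 (fzero ≟ᶠ i) +_) (∑-map fsuc (allFin n) _) ⟩
  𝟙 (fzero ≟ᶠ i) + ∑[ j ∈ allFin n ] 𝟙 (fsuc j ≟ᶠ i)
    ≡⟨ split i ⟩
  1 ∎
  where
  open ≡-Reasoning
  split : ∀ i → 𝟙 (fzero ≟ᶠ i) + ∑[ j ∈ allFin n ] 𝟙 (fsuc j ≟ᶠ i) ≡ 1
  split fzero    = cong suc (trans (∑-cong (allFin n) (λ j → 𝟙-no (λ ()) (fsuc j ≟ᶠ fzero))) (∑-zero (allFin n)))
  split (fsuc i) = trans (∑-cong (allFin n) (λ j → 𝟙-⇔ Finₚ.suc-injective (cong fsuc) (fsuc j ≟ᶠ fsuc i) (j ≟ᶠ i)))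
                         (occursOnce (allFin-enumeratesOnce n) i)

cartesianProduct-enumeratesOnce :
  {_≟A_ : DecidableEquality A} {_≟B_ : DecidableEquality B} {xs : List A} {ys : List B} →
  EnumeratesOnce _≟A_ xs → EnumeratesOnce _≟B_ ys →
  EnumeratesOnce (Productₚ.≡-dec _≟A_ _≟B_) (cartesianProduct xs ys)
cartesianProduct-enumeratesOnce {A = A} {B = B} {_≟A_ = _≟A_} {_≟B_} {xs} {ys} onceA onceB .occursOnce (a , b) = begin
  ∑ (cartesianProduct xs ys) (λ z → 𝟙 (z ≟ᵖ (a , b)))   ≡⟨ ∑-cartesianProduct xs ys _ ⟩
  ∑[ x ∈ xs ] ∑[ y ∈ ys ] 𝟙 ((x , y) ≟ᵖ (a , b))
    ≡⟨ ∑-cong xs (λ x → ∑-cong ys (λ y → 𝟙-× (x ≟A a) (y ≟B b) _ (λ { refl → refl , refl }) (λ { refl refl → refl }))) ⟩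
  ∑[ x ∈ xs ] ∑[ y ∈ ys ] (𝟙 (x ≟A a) * 𝟙 (y ≟B b))     ≡⟨ ∑-cong xs (λ x → ∑-*ˡ ys (𝟙 (x ≟A a)) _) ⟩
  ∑[ x ∈ xs ] (𝟙 (x ≟A a) * ∑[ y ∈ ys ] 𝟙 (y ≟B b))     ≡⟨ ∑-select onceA _ a ⟩
  ∑[ y ∈ ys ] 𝟙 (y ≟B b)                                ≡⟨ occursOnce onceB b ⟩
  1                                                     ∎
  where
  open ≡-Reasoning
  _≟ᵖ_ : DecidableEquality (A × B)
  _≟ᵖ_ = Productₚ.≡-dec _≟A_ _≟B_

vectors : List A → (k : ℕ) → List (Vec A k)
vectors xs zero    = [] ∷ []
vectors xs (suc k) = concatMap (λ a → map (a ∷_) (vectors xs k)) xs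

∑-vectors-suc : (xs : List A) (k : ℕ) (f : Vec A (suc k) → ℕ) →
                ∑ (vectors xs (suc k)) f ≡ ∑[ a ∈ xs ] ∑[ t ∈ vectors xs k ] f (a ∷ t)
∑-vectors-suc xs k f = trans (∑-concatMap _ xs f) (∑-cong xs (λ a → ∑-map (a ∷_) (vectors xs k) f))

vectors-enumeratesOnce : {_≟_ : DecidableEquality A} {xs : List A} → EnumeratesOnce _≟_ xs →
                         (k : ℕ) → EnumeratesOnce (Vecₚ.≡-dec _≟_) (vectors xs k)
vectors-enumeratesOnce once zero    .occursOnce []      = refl
vectors-enumeratesOnce {A = A} {_≟_ = _≟_} {xs} once (suc k) .occursOnce (a ∷ v) = begin
  ∑ (vectors xs (suc k)) (λ t → 𝟙 (t ≟ⱽ (a ∷ v)))          ≡⟨ ∑-vectors-suc xs k _ ⟩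
  ∑[ b ∈ xs ] ∑[ t ∈ vectors xs k ] 𝟙 ((b ∷ t) ≟ⱽ (a ∷ v))
    ≡⟨ ∑-cong xs (λ b → ∑-cong (vectors xs k) (λ t → 𝟙-× (b ≟ a) (t ≟ⱽ v) _ Vecₚ.∷-injective (λ { refl refl → refl }))) ⟩
  ∑[ b ∈ xs ] ∑[ t ∈ vectors xs k ] (𝟙 (b ≟ a) * 𝟙 (t ≟ⱽ v))
    ≡⟨ ∑-cong xs (λ b → ∑-*ˡ (vectors xs k) (𝟙 (b ≟ a)) _) ⟩
  ∑[ b ∈ xs ] (𝟙 (b ≟ a) * ∑[ t ∈ vectors xs k ] 𝟙 (t ≟ⱽ v)) ≡⟨ ∑-select once _ a ⟩
  ∑[ t ∈ vectors xs k ] 𝟙 (t ≟ⱽ v)                         ≡⟨ occursOnce (vectors-enumeratesOnce once k) v ⟩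
  1                                                        ∎
  where
  open ≡-Reasoning
  _≟ⱽ_ : ∀ {n} → DecidableEquality (Vec A n)
  _≟ⱽ_ = Vecₚ.≡-dec _≟_

∑-vectors-all : (xs : List A) {P : Pred A ℓ} (P? : Decidable P) (k : ℕ) →
                ∑[ t ∈ vectors xs k ] 𝟙 (All.all? P? t) ≡ (∑[ x ∈ xs ] 𝟙 (P? x)) ^ k
∑-vectors-all xs P? zero    = refl
∑-vectors-all xs P? (suc k) = begin
  ∑ (vectors xs (suc k)) (λ t → 𝟙 (All.all? P? t))              ≡⟨ ∑-vectors-suc xs k _ ⟩
  ∑[ x ∈ xs ] ∑[ t ∈ vectors xs k ] 𝟙 (All.all? P? (x ∷ t))     ≡⟨ ∑-cong xs (λ x → ∑-cong (vectors xs k) (λ t →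
                                                                    𝟙-× (P? x) (All.all? P? t) _ (λ { (px ∷ pt) → px , pt }) _∷_)) ⟩
  ∑[ x ∈ xs ] ∑[ t ∈ vectors xs k ] (𝟙 (P? x) * 𝟙 (All.all? P? t))
                                                                   ≡⟨ ∑-cong xs (λ x → ∑-*ˡ (vectors xs k) (𝟙 (P? x)) _) ⟩
  ∑[ x ∈ xs ] (𝟙 (P? x) * ∑[ t ∈ vectors xs k ] 𝟙 (All.all? P? t)) ≡⟨ ∑-*ʳ xs _ _ ⟩
  ∑[ x ∈ xs ] 𝟙 (P? x) * ∑[ t ∈ vectors xs k ] 𝟙 (All.all? P? t)
                                                                   ≡⟨ cong (∑[ x ∈ xs ] 𝟙 (P? x) *_) (∑-vectors-all xs P? k) ⟩
  (∑[ x ∈ xs ] 𝟙 (P? x)) ^ suc k                                   ∎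
  where open ≡-Reasoning

length≡∑1 : (xs : List A) → length xs ≡ ∑[ x ∈ xs ] 1
length≡∑1 xs = sym (trans (∑-const xs 1) (*-identityʳ (length xs)))

length-vectors : (xs : List A) (k : ℕ) → length (vectors xs k) ≡ length xs ^ k
length-vectors xs k = begin
  length (vectors xs k)                                     ≡⟨ length≡∑1 (vectors xs k) ⟩
  ∑[ t ∈ vectors xs k ] 1                                   ≡⟨ ∑-cong (vectors xs k) (λ t → 𝟙-yes (All.universal _ t) (All.all? ⊤? t)) ⟨
  ∑[ t ∈ vectors xs k ] 𝟙 (All.all? ⊤? t)                   ≡⟨ ∑-vectors-all xs ⊤? k ⟩
  (∑[ x ∈ xs ] 1) ^ k                                       ≡⟨ cong (_^ k) (length≡∑1 xs) ⟨
  length xs ^ k                                             ∎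
  where
  open ≡-Reasoning
  ⊤? : Decidable {A = A} (λ _ → ⊤)
  ⊤? _ = yes tt

All¬⇒¬Any : {P : Pred A ℓ} {n : ℕ} {xs : Vec A n} → All (¬_ ∘ P) xs → ¬ Any P xs
All¬⇒¬Any (¬p ∷ _)   (here p)  = ¬p p
All¬⇒¬Any (_ ∷ ¬ps) (there p) = All¬⇒¬Any ¬ps p

¬Any⇒All¬ : {P : Pred A ℓ} {n : ℕ} (xs : Vec A n) → ¬ Any P xs → All (¬_ ∘ P) xs
¬Any⇒All¬ []       _    = []
¬Any⇒All¬ (x ∷ xs) ¬any = (¬any ∘ here) ∷ ¬Any⇒All¬ xs (¬any ∘ there)

¬All⇒Any¬ : {P : Pred A ℓ} (P? : Decidable P) {n : ℕ} (xs : Vec A n) → ¬ All P xs → Any (¬_ ∘ P) xs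
¬All⇒Any¬ P? []       ¬all = ⊥-elim (¬all [])
¬All⇒Any¬ P? (x ∷ xs) ¬all with P? x
... | yes px = there (¬All⇒Any¬ P? xs (¬all ∘ (px ∷_)))
... | no ¬px = here ¬px

∑-vectors-any : (xs : List A) {P : Pred A ℓ} (P? : Decidable P) (k : ℕ) →
                ∑[ t ∈ vectors xs k ] 𝟙 (Any.any? P? t) + (∑[ x ∈ xs ] 𝟙 (¬? (P? x))) ^ k ≡ length xs ^ k
∑-vectors-any xs P? k = begin
  ∑[ t ∈ vectors xs k ] 𝟙 (Any.any? P? t) + (∑[ x ∈ xs ] 𝟙 (¬? (P? x))) ^ k
    ≡⟨ cong (∑[ t ∈ vectors xs k ] 𝟙 (Any.any? P? t) +_) (∑-vectors-all xs (¬? ∘ P?) k) ⟨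
  ∑[ t ∈ vectors xs k ] 𝟙 (Any.any? P? t) + ∑[ t ∈ vectors xs k ] 𝟙 (All.all? (¬? ∘ P?) t)
    ≡⟨ cong (∑[ t ∈ vectors xs k ] 𝟙 (Any.any? P? t) +_)
            (∑-cong (vectors xs k) (λ t → 𝟙-⇔ All¬⇒¬Any (¬Any⇒All¬ t) (All.all? (¬? ∘ P?) t) (¬? (Any.any? P? t)))) ⟩
  ∑[ t ∈ vectors xs k ] 𝟙 (Any.any? P? t) + ∑[ t ∈ vectors xs k ] 𝟙 (¬? (Any.any? P? t))
    ≡⟨ ∑-¬? (vectors xs k) (Any.any? P?) ⟩
  length (vectors xs k) ≡⟨ length-vectors xs k ⟩
  length xs ^ k         ∎
  where
  open ≡-Reasoning

-- Counting residues and units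

length-allFin : (n : ℕ) → length (allFin n) ≡ n
length-allFin n = Listₚ.length-tabulate (λ i → i)

∑-allFin-const : (n k : ℕ) → ∑[ i ∈ allFin n ] k ≡ n * k
∑-allFin-const n k = trans (∑-const (allFin n) k) (cong (_* k) (length-allFin n))

∑-combine : (e d : ℕ) (f : Fin (e * d) → ℕ) →
            ∑ (allFin (e * d)) f ≡ ∑[ x ∈ allFin e ] ∑[ y ∈ allFin d ] f (combine x y)
∑-combine e d f = trans
  (∑-reindex (cartesianProduct-enumeratesOnce (allFin-enumeratesOnce e) (allFin-enumeratesOnce d))
             (allFin-enumeratesOnce (e * d))
             (mk↔ₛ′ (uncurry combine) (remQuot d) (Finₚ.combine-remQuot {e} d) (λ (x , y) → Finₚ.remQuot-combine x y)) f)
  (∑-cartesianProduct (allFin e) (allFin d) _)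

∑-residue-class : (e d : ℕ) {P : Pred (Fin (e * d)) ℓ} (P? : Decidable P) (y₀ : Fin d) →
                  (∀ x y → P (combine x y) → y ≡ y₀) → (∀ x → P (combine x y₀)) →
                  ∑[ i ∈ allFin (e * d) ] 𝟙 (P? i) ≡ e
∑-residue-class e d P? y₀ only-y₀ at-y₀ = begin
  ∑[ i ∈ allFin (e * d) ] 𝟙 (P? i)                         ≡⟨ ∑-combine e d _ ⟩
  ∑[ x ∈ allFin e ] ∑[ y ∈ allFin d ] 𝟙 (P? (combine x y))
    ≡⟨ ∑-cong (allFin e) (λ x → ∑-cong (allFin d) (λ y →
         trans (𝟙-⇔ (only-y₀ x y) (λ { refl → at-y₀ x }) _ (y ≟ᶠ y₀)) (sym (*-identityʳ _)))) ⟩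
  ∑[ x ∈ allFin e ] ∑[ y ∈ allFin d ] (𝟙 (y ≟ᶠ y₀) * 1)
    ≡⟨ ∑-cong (allFin e) (λ x → ∑-select (allFin-enumeratesOnce d) _ y₀) ⟩
  ∑[ x ∈ allFin e ] 1                                      ≡⟨ ∑-allFin-const e 1 ⟩
  e * 1                                                    ≡⟨ *-identityʳ e ⟩
  e                                                        ∎
  where open ≡-Reasoning

count-multiples : {N : ℕ} (e d : ℕ) .{{_ : NonZero d}} → N ≡ e * d →
                  ∑[ i ∈ allFin N ] 𝟙 (d ∣? toℕ i) ≡ e
count-multiples e zero    {{d≢0}} _    = ⊥-elim (≢-nonZero⁻¹ zero {{d≢0}} refl)
count-multiples e (suc d) refl = ∑-residue-class e (suc d) _ fzero only-0 at-0
  where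
  d∣d*x : ∀ x → suc d ∣ suc d * toℕ x
  d∣d*x x = m∣m*n (toℕ x)
  only-0 : ∀ x y → suc d ∣ toℕ (combine x y) → y ≡ fzero
  only-0 x y d∣ = Finₚ.toℕ-injective (trans (sym (m<n⇒m%n≡m (Finₚ.toℕ<n y))) (n∣m⇒m%n≡0 (toℕ y) (suc d) d∣y))
    where
    d∣y : suc d ∣ toℕ y
    d∣y = ∣m+n∣m⇒∣n (subst (suc d ∣_) (Finₚ.toℕ-combine x y) d∣) (d∣d*x x)
  at-0 : ∀ x → suc d ∣ toℕ (combine x fzero)
  at-0 x = subst (suc d ∣_) (sym (trans (Finₚ.toℕ-combine x fzero) (+-identityʳ _))) (d∣d*x x)

count-multiples-suc : {N : ℕ} (e d : ℕ) .{{_ : NonZero d}} → N ≡ e * d →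
                      ∑[ i ∈ allFin N ] 𝟙 (d ∣? suc (toℕ i)) ≡ e
count-multiples-suc e zero    {{d≢0}} _    = ⊥-elim (≢-nonZero⁻¹ zero {{d≢0}} refl)
count-multiples-suc e (suc d) refl = ∑-residue-class e (suc d) _ (fromℕ d) only-last at-last
  where
  toℕ-suc-combine : ∀ x y → suc (toℕ (combine x y)) ≡ suc d * toℕ x + suc (toℕ y)
  toℕ-suc-combine x y = trans (cong suc (Finₚ.toℕ-combine x y)) (sym (+-suc _ (toℕ y)))
  only-last : ∀ x y → suc d ∣ suc (toℕ (combine x y)) → y ≡ fromℕ d
  only-last x y d∣ = Finₚ.toℕ-injective (trans y≡d (sym (Finₚ.toℕ-fromℕ d)))
    where
    d∣suc-y : suc d ∣ suc (toℕ y)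
    d∣suc-y = ∣m+n∣m⇒∣n (subst (suc d ∣_) (toℕ-suc-combine x y) d∣) (m∣m*n (toℕ x))
    y≡d : toℕ y ≡ d
    y≡d = ≤-antisym (s≤s⁻¹ (Finₚ.toℕ<n y)) (s≤s⁻¹ (∣⇒≤ d∣suc-y))
  at-last : ∀ x → suc d ∣ suc (toℕ (combine x (fromℕ d)))
  at-last x = subst (suc d ∣_) (sym (trans (toℕ-suc-combine x (fromℕ d))
                                           (cong (λ t → suc d * toℕ x + suc t) (Finₚ.toℕ-fromℕ d))))
                    (∣m∣n⇒∣m+n (m∣m*n (toℕ x)) ∣-refl)

tuples≡vectors : (k q : ℕ) → tuples k q ≡ vectors (allFin q) k
tuples≡vectors zero    q = refl
tuples≡vectors (suc k) q = cong (λ l → concatMap (λ a → map (a ∷_) l) (allFin q)) (tuples≡vectors k q)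

phi-complement : (m c : ℕ) → phi m c + (∑[ i ∈ allFin c ] 𝟙 (¬? (coprime? (suc (toℕ i)) c))) ^ m ≡ c ^ m
phi-complement m c = begin
  phi m c + X ^ m                                      ≡⟨ cong (_+ X ^ m) (length-filter unit? (tuples m c)) ⟩
  ∑ (tuples m c) (λ t → 𝟙 (unit? t)) + X ^ m           ≡⟨ cong (λ l → ∑ l (λ t → 𝟙 (unit? t)) + X ^ m) (tuples≡vectors m c) ⟩
  ∑ (vectors (allFin c) m) (λ t → 𝟙 (unit? t)) + X ^ m ≡⟨ ∑-vectors-any (allFin c) _ m ⟩
  length (allFin c) ^ m                                ≡⟨ cong (_^ m) (length-allFin c) ⟩
  c ^ m                                                ∎
  where
  open ≡-Reasoning
  unit? : (t : Vec (Fin c) m) → Dec (Any (λ i → Coprime (suc (toℕ i)) c) t)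
  unit? = Any.any? (λ i → coprime? (suc (toℕ i)) c)
  X : ℕ
  X = ∑[ i ∈ allFin c ] 𝟙 (¬? (coprime? (suc (toℕ i)) c))

phi[1+m,1]≡1 : (m : ℕ) → phi (suc m) 1 ≡ 1
phi[1+m,1]≡1 m = trans (sym (+-identityʳ _)) (trans (phi-complement (suc m) 1) (^-zeroˡ (suc m)))

module _ {p : ℕ} (p-prime : Prime p) where

  private instance
    p≢0 : NonZero p
    p≢0 = prime⇒nonZero p-prime

  1<p : 1 < p
  1<p = nonTrivial⇒n>1 p {{prime⇒nonTrivial p-prime}}

  p∤1 : ¬ p ∣ 1
  p∤1 p∣1 = nonTrivial⇒≢1 {{prime⇒nonTrivial p-prime}} (∣1⇒≡1 p∣1)

  ¬∣⇒coprime-^ : ∀ {a} → ¬ p ∣ a → ∀ t → Coprime a (p ^ t)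
  ¬∣⇒coprime-^ p∤a zero    (d∣a , d∣1) = ∣1⇒≡1 d∣1
  ¬∣⇒coprime-^ p∤a (suc t) (d∣a , d∣p^t′) = ¬∣⇒coprime-^ p∤a t (d∣a , coprime-divisor d⊥p d∣p^t′)
    where
    d⊥p : Coprime _ p
    d⊥p (e∣d , e∣p) with prime⇒irreducible p-prime e∣p
    ... | inj₁ e≡1   = e≡1
    ... | inj₂ refl  = ⊥-elim (p∤a (∣-trans e∣d d∣a))

  coprime-^⇒¬∣ : ∀ {a t} → 1 ≤ t → Coprime a (p ^ t) → ¬ p ∣ a
  coprime-^⇒¬∣ {t = suc t} _ a⊥p^t p∣a = p∤1 (subst (p ∣_) (a⊥p^t (p∣a , m∣m*n (p ^ t))) ∣-refl)

  ¬coprime-^⇔∣ : ∀ {a t} → 1 ≤ t → (¬ Coprime a (p ^ t)) ⇔ p ∣ a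
  ¬coprime-^⇔∣ {a} {t} 1≤t = mk⇔ to (λ p∣a a⊥p^t → coprime-^⇒¬∣ 1≤t a⊥p^t p∣a)
    where
    to : ¬ Coprime a (p ^ t) → p ∣ a
    to ¬a⊥p^t with p ∣? a
    ... | yes p∣a = p∣a
    ... | no  p∤a = ⊥-elim (¬a⊥p^t (¬∣⇒coprime-^ p∤a t))

  p^-injective : ∀ {i j} → p ^ i ≡ p ^ j → i ≡ j
  p^-injective {i} {j} p^i≡p^j with <-cmp i j
  ... | tri< i<j _ _ = ⊥-elim (<⇒≢ (^-monoʳ-< p 1<p i<j) p^i≡p^j)
  ... | tri≈ _ i≡j _ = i≡j
  ... | tri> _ _ j<i = ⊥-elim (<⇒≢ (^-monoʳ-< p 1<p j<i) (sym p^i≡p^j))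

  p^-split : ∀ {j s} → j ≤ s → p ^ s ≡ p ^ (s ∸ j) * p ^ j
  p^-split {j} {s} j≤s = trans (cong (p ^_) (sym (m∸n+n≡m j≤s))) (^-distribˡ-+-* p (s ∸ j) j)

  p^-pred : ∀ {t} → 1 ≤ t → p ^ t ≡ p ^ (t ∸ 1) * p
  p^-pred {suc t} _ = *-comm p (p ^ t)

  count-nonunits : ∀ {t} → 1 ≤ t → ∑[ a ∈ allFin (p ^ t) ] 𝟙 (¬? (coprime? (toℕ a) (p ^ t))) ≡ p ^ (t ∸ 1)
  count-nonunits {t} 1≤t =
    trans (∑-cong (allFin (p ^ t)) (λ a → 𝟙-⇔ (to (¬coprime-^⇔∣ 1≤t)) (from (¬coprime-^⇔∣ 1≤t)) _ (p ∣? toℕ a)))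
          (count-multiples (p ^ (t ∸ 1)) p (p^-pred 1≤t))
    where open Equivalence

  phi-prime-power : ∀ m {t} → 1 ≤ t → phi m (p ^ t) + (p ^ (t ∸ 1)) ^ m ≡ (p ^ t) ^ m
  phi-prime-power m {t} 1≤t =
    trans (cong (λ X → phi m (p ^ t) + X ^ m) (sym count-nonunits-suc)) (phi-complement m (p ^ t))
    where
    open Equivalence
    count-nonunits-suc : ∑[ i ∈ allFin (p ^ t) ] 𝟙 (¬? (coprime? (suc (toℕ i)) (p ^ t))) ≡ p ^ (t ∸ 1)
    count-nonunits-suc =
      trans (∑-cong (allFin (p ^ t)) (λ i → 𝟙-⇔ (to (¬coprime-^⇔∣ 1≤t)) (from (¬coprime-^⇔∣ 1≤t)) _ (p ∣? suc (toℕ i))))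
            (count-multiples-suc (p ^ (t ∸ 1)) p (p^-pred 1≤t))

-- Arithmetic modulo q

module Modular (q : ℕ) .{{_ : NonZero q}} where

  -- A record rather than x % q ≡ y % q, so that x and y remain inferable.
  infix 4 _≈_
  record _≈_ (x y : ℕ) : Set where
    constructor mk≈
    field %-≡ : x % q ≡ y % q

  ≈-isEquivalence : IsEquivalence _≈_
  ≈-isEquivalence = record
    { refl  = mk≈ refl
    ; sym   = λ (mk≈ e) → mk≈ (sym e)
    ; trans = λ (mk≈ e) (mk≈ f) → mk≈ (trans e f)
    }

  ≈-setoid : Setoid 0ℓ 0ℓ
  ≈-setoid = record { isEquivalence = ≈-isEquivalence }

  open IsEquivalence ≈-isEquivalence public
    using () renaming (refl to ≈-refl; sym to ≈-sym; trans to ≈-trans; reflexive to ≡⇒≈)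

  module ≈-Reasoning = SetoidReasoning ≈-setoid

  +-cong : ∀ {a b c d} → a ≈ b → c ≈ d → a + c ≈ b + d
  +-cong {a} {b} {c} {d} (mk≈ e) (mk≈ f) = mk≈ (begin
    (a + c) % q           ≡⟨ %-distribˡ-+ a c q ⟩
    (a % q + c % q) % q   ≡⟨ cong₂ (λ x y → (x + y) % q) e f ⟩
    (b % q + d % q) % q   ≡⟨ %-distribˡ-+ b d q ⟨
    (b + d) % q           ∎)
    where open ≡-Reasoning

  *-cong : ∀ {a b c d} → a ≈ b → c ≈ d → a * c ≈ b * d
  *-cong {a} {b} {c} {d} (mk≈ e) (mk≈ f) = mk≈ (begin
    (a * c) % q           ≡⟨ %-distribˡ-* a c q ⟩
    (a % q * (c % q)) % q ≡⟨ cong₂ (λ x y → (x * y) % q) e f ⟩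
    (b % q * (d % q)) % q ≡⟨ %-distribˡ-* b d q ⟨
    (b * d) % q           ∎)
    where open ≡-Reasoning

  %-≈ : ∀ x → x % q ≈ x
  %-≈ x = mk≈ (m%n%n≡m%n x q)

  reduce : ℕ → Fin q
  reduce x = fromℕ< (m%n<n x q)

  toℕ-reduce : ∀ x → toℕ (reduce x) ≈ x
  toℕ-reduce x = ≈-trans (≡⇒≈ (Finₚ.toℕ-fromℕ< (m%n<n x q))) (%-≈ x)

  toℕ-injective : {a b : Fin q} → toℕ a ≈ toℕ b → a ≡ b
  toℕ-injective {a} {b} (mk≈ e) =
    Finₚ.toℕ-injective (trans (sym (m<n⇒m%n≡m (Finₚ.toℕ<n a))) (trans e (m<n⇒m%n≡m (Finₚ.toℕ<n b))))

  toℕ-lookup-tabulate-reduce : {n : ℕ} (f : Fin n → ℕ) (k : Fin n) → toℕ (lookup (tabulate (λ k → reduce (f k))) k) ≈ f k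
  toℕ-lookup-tabulate-reduce f k = ≈-trans (≡⇒≈ (cong toℕ (Vecₚ.lookup∘tabulate (reduce ∘ f) k))) (toℕ-reduce (f k))

  pointwise-≈⇒≡ : {n : ℕ} (ys xs : Vec (Fin q) n) → (∀ k → toℕ (lookup ys k) ≈ toℕ (lookup xs k)) → ys ≡ xs
  pointwise-≈⇒≡ ys xs ys≈xs = begin
    ys                   ≡⟨ Vecₚ.tabulate∘lookup ys ⟨
    tabulate (lookup ys) ≡⟨ Vecₚ.tabulate-cong (toℕ-injective ∘ ys≈xs) ⟩
    tabulate (lookup xs) ≡⟨ Vecₚ.tabulate∘lookup xs ⟩
    xs                   ∎
    where open ≡-Reasoning

  0%q≡0 : 0 % q ≡ 0
  0%q≡0 = m<n⇒m%n≡m (>-nonZero⁻¹ q)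

  ∣⇒≈0 : ∀ {x} → q ∣ x → x ≈ 0
  ∣⇒≈0 {x} q∣x = mk≈ (trans (n∣m⇒m%n≡0 x q q∣x) (sym 0%q≡0))

  ≈0⇒∣ : ∀ {x} → x ≈ 0 → q ∣ x
  ≈0⇒∣ {x} (mk≈ e) = m%n≡0⇒n∣m x q (trans e 0%q≡0)

  *-zeroʳ-≈ : ∀ a {y} → y ≈ 0 → a * y ≈ 0
  *-zeroʳ-≈ a y≈0 = ≈-trans (*-cong (≈-refl {a}) y≈0) (≡⇒≈ (*-zeroʳ a))

  neg : ℕ → ℕ
  neg x = q ∸ x % q

  neg-cong : ∀ {x y} → x ≈ y → neg x ≡ neg y
  neg-cong (mk≈ e) = cong (q ∸_) e

  +-inverseʳ : ∀ x → x + neg x ≈ 0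
  +-inverseʳ x = begin
    x + neg x           ≈⟨ +-cong (%-≈ x) ≈-refl ⟨
    x % q + (q ∸ x % q) ≡⟨ m+[n∸m]≡n (<⇒≤ (m%n<n x q)) ⟩
    q                   ≈⟨ ∣⇒≈0 ∣-refl ⟩
    0                   ∎
    where open ≈-Reasoning

  +-cancelˡ : ∀ x {y z} → x + y ≈ x + z → y ≈ z
  +-cancelˡ x {y} {z} x+y≈x+z = begin
    y                   ≡⟨ +-identityˡ y ⟨
    0 + y               ≈⟨ +-cong (≈-sym (≈-trans (≡⇒≈ (+-comm (neg x) x)) (+-inverseʳ x))) ≈-refl ⟩
    neg x + x + y       ≡⟨ +-assoc (neg x) x y ⟩
    neg x + (x + y)     ≈⟨ +-cong (≈-refl {neg x}) x+y≈x+z ⟩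
    neg x + (x + z)     ≡⟨ +-assoc (neg x) x z ⟨
    neg x + x + z       ≈⟨ +-cong (≈-trans (≡⇒≈ (+-comm (neg x) x)) (+-inverseʳ x)) ≈-refl ⟩
    0 + z               ≡⟨ +-identityˡ z ⟩
    z                   ∎
    where open ≈-Reasoning

  +-neg-cancel : ∀ a b → a + (b + neg a) ≈ b
  +-neg-cancel a b = begin
    a + (b + neg a) ≡⟨ exchange a b (neg a) ⟩
    b + (a + neg a) ≈⟨ +-cong (≈-refl {b}) (+-inverseʳ a) ⟩
    b + 0           ≡⟨ +-identityʳ b ⟩
    b               ∎
    where
    open ≈-Reasoning
    exchange : ∀ a b c → a + (b + c) ≡ b + (a + c)
    exchange = solve-∀

  +≈0⇒≈0 : ∀ {a b} → a ≈ 0 → a + b ≈ 0 → b ≈ 0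
  +≈0⇒≈0 {a} {b} a≈0 a+b≈0 = +-cancelˡ a (≈-trans a+b≈0 (≈-trans (≈-sym a≈0) (≡⇒≈ (sym (+-identityʳ a)))))

  ∣-resp-≈ : ∀ {d x y} → d ∣ q → x ≈ y → d ∣ x → d ∣ y
  ∣-resp-≈ d∣q (mk≈ e) d∣x = ∣n∣m%n⇒∣m d∣q (subst (_ ∣_) e (%-presˡ-∣ d∣x d∣q))

  -- Bézout gives x a ≡ 1 or x a ≡ -1; in the second case (q - 1) x is the inverse.
  unit-inverse : ∀ {a} → Coprime a q → Σ ℕ (λ e → e * a ≈ 1)
  unit-inverse {a} c with coprime-Bézout c
  ... | Bézout.+- x y eq = x , (begin
    x * a     ≡⟨ eq ⟨
    1 + y * q ≈⟨ +-cong (≈-refl {1}) (∣⇒≈0 (n∣m*n y)) ⟩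
    1 + 0     ∎)
    where open ≈-Reasoning
  ... | Bézout.-+ x y eq = pred q * x , +-cancelˡ (x * a) (begin
    x * a + pred q * x * a   ≡⟨ cong (x * a +_) (*-assoc (pred q) x a) ⟩
    suc (pred q) * (x * a)   ≡⟨ cong (_* (x * a)) (suc-pred q) ⟩
    q * (x * a)              ≈⟨ ∣⇒≈0 (m∣m*n (x * a)) ⟩
    0                        ≈⟨ ∣⇒≈0 (n∣m*n y) ⟨
    y * q                    ≡⟨ trans (+-comm (x * a) 1) eq ⟨
    x * a + 1                ∎)
    where open ≈-Reasoning

All-insertAt⁺ : {P : Pred A ℓ} {n : ℕ} (xs : Vec A n) (i : Fin (suc n)) {x : A} →
                P x → All P xs → All P (insertAt xs i x)
All-insertAt⁺ xs       fzero    px pxs        = px ∷ pxs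
All-insertAt⁺ (y ∷ xs) (fsuc i) px (py ∷ pxs) = py ∷ All-insertAt⁺ xs i px pxs

All-insertAt⁻ : {P : Pred A ℓ} {n : ℕ} (xs : Vec A n) (i : Fin (suc n)) {x : A} →
                All P (insertAt xs i x) → All P xs
All-insertAt⁻ xs       fzero    (_ ∷ pxs)  = pxs
All-insertAt⁻ (y ∷ xs) (fsuc i) (py ∷ pxs) = py ∷ All-insertAt⁻ xs i pxs

-- n × 2 matrices over ℤ/q

module TwoColumns (q : ℕ) .{{_ : NonZero q}} where

  open Modular q

  Z : Set
  Z = Fin q

  0ᶻ : Z
  0ᶻ = reduce 0

  toℕ-0ᶻ : toℕ 0ᶻ ≡ 0
  toℕ-0ᶻ = trans (Finₚ.toℕ-fromℕ< (m%n<n 0 q)) 0%q≡0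

  allVectors : (k : ℕ) → List (Vec Z k)
  allVectors = vectors (allFin q)

  allVectors-enumeratesOnce : (k : ℕ) → EnumeratesOnce (Vecₚ.≡-dec _≟ᶠ_) (allVectors k)
  allVectors-enumeratesOnce = vectors-enumeratesOnce (allFin-enumeratesOnce q)

  allMatrices≡vectors : (n m : ℕ) → allMatrices n m q ≡ vectors (allVectors m) n
  allMatrices≡vectors zero    m = refl
  allMatrices≡vectors (suc n) m =
    cong₂ (λ l rs → concatMap (λ r → map (r ∷_) l) rs) (allMatrices≡vectors n m) (tuples≡vectors m q)

  fromColumns : {n : ℕ} → Vec Z n → Vec Z n → Matrix n 2 q
  fromColumns = zipWith (λ a b → a ∷ b ∷ [])

  columns : {n : ℕ} → Matrix n 2 q → Vec Z n × Vec Z n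
  columns []                   = [] , []
  columns ((a ∷ b ∷ []) ∷ rows) = let (u , v) = columns rows in a ∷ u , b ∷ v

  columns↔ : {n : ℕ} → (Vec Z n × Vec Z n) ↔ Matrix n 2 q
  columns↔ = mk↔ₛ′ (uncurry fromColumns) columns fromColumns-columns columns-fromColumns
    where
    fromColumns-columns : ∀ {n} (A : Matrix n 2 q) → uncurry fromColumns (columns A) ≡ A
    fromColumns-columns []                   = refl
    fromColumns-columns ((a ∷ b ∷ []) ∷ rows) = cong ((a ∷ b ∷ []) ∷_) (fromColumns-columns rows)
    columns-fromColumns : ∀ {n} (uv : Vec Z n × Vec Z n) → columns (uncurry fromColumns uv) ≡ uv
    columns-fromColumns ([]    , [])    = refl
    columns-fromColumns (a ∷ u , b ∷ v) = cong (λ (u′ , v′) → a ∷ u′ , b ∷ v′) (columns-fromColumns (u , v))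

  solutionCount : {n : ℕ} → Vec Z n → Vec Z n → ℕ
  solutionCount u v = numSolutions (fromColumns u v)

  Etilde-columns : (n N : ℕ) → Etilde n 2 q N ≡
    ∑[ u ∈ allVectors n ] ∑[ v ∈ allVectors n ] (𝟙 (relPrime? (fromColumns u v)) * 𝟙 (solutionCount u v ≟ N))
  Etilde-columns n N = begin
    Etilde n 2 q N
      ≡⟨ length-filter (λ A → numSolutions A ≟ N) (filter relPrime? (allMatrices n 2 q)) ⟩
    ∑ (filter relPrime? (allMatrices n 2 q)) (λ A → 𝟙 (numSolutions A ≟ N))
      ≡⟨ ∑-filter relPrime? (allMatrices n 2 q) _ ⟩
    ∑ (allMatrices n 2 q) f
      ≡⟨ cong (λ l → ∑ l f) (allMatrices≡vectors n 2) ⟩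
    ∑ (vectors (allVectors 2) n) f
      ≡⟨ ∑-reindex (cartesianProduct-enumeratesOnce (allVectors-enumeratesOnce n) (allVectors-enumeratesOnce n))
                   (vectors-enumeratesOnce (allVectors-enumeratesOnce 2) n) columns↔ f ⟩
    ∑ (cartesianProduct (allVectors n) (allVectors n)) (f ∘ uncurry fromColumns)
      ≡⟨ ∑-cartesianProduct (allVectors n) (allVectors n) _ ⟩
    ∑[ u ∈ allVectors n ] ∑[ v ∈ allVectors n ] f (fromColumns u v) ∎
    where
    open ≡-Reasoning
    f : Matrix n 2 q → ℕ
    f A = 𝟙 (relPrime? A) * 𝟙 (numSolutions A ≟ N)

  HasUnit : {n : ℕ} → Vec Z n → Set
  HasUnit = Any Invertible

  hasUnit? : {n : ℕ} (u : Vec Z n) → Dec (HasUnit u)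
  hasUnit? = Any.any? (λ a → coprime? (toℕ a) q)

  relPrime⇒hasUnit : {n : ℕ} (u v : Vec Z n) → RelPrime (fromColumns u v) → HasUnit u ⊎ HasUnit v
  relPrime⇒hasUnit (a ∷ u) (b ∷ v) (here (here unit))         = inj₁ (here unit)
  relPrime⇒hasUnit (a ∷ u) (b ∷ v) (here (there (here unit))) = inj₂ (here unit)
  relPrime⇒hasUnit (a ∷ u) (b ∷ v) (there rp) with relPrime⇒hasUnit u v rp
  ... | inj₁ unit = inj₁ (there unit)
  ... | inj₂ unit = inj₂ (there unit)

  hasUnit⇒relPrimeˡ : {n : ℕ} (u v : Vec Z n) → HasUnit u → RelPrime (fromColumns u v)
  hasUnit⇒relPrimeˡ (a ∷ u) (b ∷ v) (here unit) = here (here unit)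
  hasUnit⇒relPrimeˡ (a ∷ u) (b ∷ v) (there hu)  = there (hasUnit⇒relPrimeˡ u v hu)

  hasUnit⇒relPrimeʳ : {n : ℕ} (u v : Vec Z n) → HasUnit v → RelPrime (fromColumns u v)
  hasUnit⇒relPrimeʳ (a ∷ u) (b ∷ v) (here unit) = here (there (here unit))
  hasUnit⇒relPrimeʳ (a ∷ u) (b ∷ v) (there hv)  = there (hasUnit⇒relPrimeʳ u v hv)

  Solves : {n : ℕ} → Vec Z n → Vec Z n → Z → Z → Set
  Solves u v x₁ x₂ = ∀ k → q ∣ toℕ (lookup u k) * toℕ x₁ + toℕ (lookup v k) * toℕ x₂

  isSolution⇔solves : {n : ℕ} (u v : Vec Z n) {x₁ x₂ : Z} →
                      IsSolution (fromColumns u v) (x₁ ∷ x₂ ∷ []) ⇔ Solves u v x₁ x₂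
  isSolution⇔solves u v = mk⇔ (to u v) (from u v)
    where
    row : ∀ a b x₁ x₂ → toℕ a * toℕ x₁ + (toℕ b * toℕ x₂ + 0) ≡ toℕ a * toℕ x₁ + toℕ b * toℕ x₂
    row a b x₁ x₂ = cong (toℕ a * toℕ x₁ +_) (+-identityʳ _)
    to : ∀ {n} (u v : Vec Z n) {x₁ x₂} → IsSolution (fromColumns u v) (x₁ ∷ x₂ ∷ []) → Solves u v x₁ x₂
    to (a ∷ u) (b ∷ v) (s ∷ _)  fzero    = subst (q ∣_) (row a b _ _) s
    to (a ∷ u) (b ∷ v) (_ ∷ ss) (fsuc k) = to u v ss k
    from : ∀ {n} (u v : Vec Z n) {x₁ x₂} → Solves u v x₁ x₂ → IsSolution (fromColumns u v) (x₁ ∷ x₂ ∷ [])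
    from []      []      s = []
    from (a ∷ u) (b ∷ v) s = subst (q ∣_) (sym (row a b _ _)) (s fzero) ∷ from u v (s ∘ fsuc)

  solutionCount≡∑ : {n : ℕ} (u v : Vec Z n) → solutionCount u v ≡
    ∑[ x₁ ∈ allFin q ] ∑[ x₂ ∈ allFin q ] 𝟙 (isSolution? (fromColumns u v) (x₁ ∷ x₂ ∷ []))
  solutionCount≡∑ u v = begin
    solutionCount u v
      ≡⟨ length-filter (isSolution? (fromColumns u v)) (tuples 2 q) ⟩
    ∑ (tuples 2 q) f
      ≡⟨ cong (λ l → ∑ l f) (tuples≡vectors 2 q) ⟩
    ∑ (allVectors 2) f
      ≡⟨ ∑-vectors-suc (allFin q) 1 f ⟩
    ∑[ x₁ ∈ allFin q ] ∑ (allVectors 1) (λ t → f (x₁ ∷ t))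
      ≡⟨ ∑-cong (allFin q) (λ x₁ → ∑-vectors-suc (allFin q) 0 _) ⟩
    ∑[ x₁ ∈ allFin q ] ∑[ x₂ ∈ allFin q ] (f (x₁ ∷ x₂ ∷ []) + 0)
      ≡⟨ ∑-cong (allFin q) (λ x₁ → ∑-cong (allFin q) (λ x₂ → +-identityʳ _)) ⟩
    ∑[ x₁ ∈ allFin q ] ∑[ x₂ ∈ allFin q ] f (x₁ ∷ x₂ ∷ []) ∎
    where
    open ≡-Reasoning
    f : Vec Z 2 → ℕ
    f x = 𝟙 (isSolution? (fromColumns u v) x)

  solutionCount-graph : {n : ℕ} (u v : Vec Z n) (r : Z → Z) {Q : Pred Z 0ℓ} (Q? : Decidable Q) →
                        (∀ x₁ x₂ → Solves u v x₁ x₂ ⇔ (x₁ ≡ r x₂ × Q x₂)) →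
                        solutionCount u v ≡ ∑[ y ∈ allFin q ] 𝟙 (Q? y)
  solutionCount-graph u v r Q? graph = begin
    solutionCount u v
      ≡⟨ solutionCount≡∑ u v ⟩
    ∑[ x₁ ∈ allFin q ] ∑[ x₂ ∈ allFin q ] 𝟙 (isSolution? (fromColumns u v) (x₁ ∷ x₂ ∷ []))
      ≡⟨ ∑-cong (allFin q) (λ x₁ → ∑-cong (allFin q) (λ x₂ → 𝟙-× (x₁ ≟ᶠ r x₂) (Q? x₂) _
           (to (graph x₁ x₂) ∘ to (isSolution⇔solves u v))
           (λ x₁≡ Qx₂ → from (isSolution⇔solves u v) (from (graph x₁ x₂) (x₁≡ , Qx₂))))) ⟩
    ∑[ x₁ ∈ allFin q ] ∑[ x₂ ∈ allFin q ] (𝟙 (x₁ ≟ᶠ r x₂) * 𝟙 (Q? x₂))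
      ≡⟨ ∑-swap (allFin q) (allFin q) _ ⟩
    ∑[ x₂ ∈ allFin q ] ∑[ x₁ ∈ allFin q ] (𝟙 (x₁ ≟ᶠ r x₂) * 𝟙 (Q? x₂))
      ≡⟨ ∑-cong (allFin q) (λ x₂ → ∑-select (allFin-enumeratesOnce q) _ (r x₂)) ⟩
    ∑[ y ∈ allFin q ] 𝟙 (Q? y) ∎
    where
    open ≡-Reasoning
    open Equivalence

  solutionCount-swap : {n : ℕ} (u v : Vec Z n) → solutionCount u v ≡ solutionCount v u
  solutionCount-swap u v = begin
    solutionCount u v
      ≡⟨ solutionCount≡∑ u v ⟩
    ∑[ x₁ ∈ allFin q ] ∑[ x₂ ∈ allFin q ] 𝟙 (isSolution? (fromColumns u v) (x₁ ∷ x₂ ∷ []))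
      ≡⟨ ∑-swap (allFin q) (allFin q) _ ⟩
    ∑[ x₂ ∈ allFin q ] ∑[ x₁ ∈ allFin q ] 𝟙 (isSolution? (fromColumns u v) (x₁ ∷ x₂ ∷ []))
      ≡⟨ ∑-cong (allFin q) (λ x₂ → ∑-cong (allFin q) (λ x₁ → 𝟙-⇔ (swapped u v) (swapped v u) _ _)) ⟩
    ∑[ x₂ ∈ allFin q ] ∑[ x₁ ∈ allFin q ] 𝟙 (isSolution? (fromColumns v u) (x₂ ∷ x₁ ∷ []))
      ≡⟨ solutionCount≡∑ v u ⟨
    solutionCount v u ∎
    where
    open ≡-Reasoning
    swapped : ∀ {n} (u v : Vec Z n) {x₁ x₂} →
              IsSolution (fromColumns u v) (x₁ ∷ x₂ ∷ []) → IsSolution (fromColumns v u) (x₂ ∷ x₁ ∷ [])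
    swapped u v {x₁} {x₂} s = Equivalence.from (isSolution⇔solves v u) (λ k →
      subst (q ∣_) (+-comm (toℕ (lookup u k) * toℕ x₁) _) (Equivalence.to (isSolution⇔solves u v) s k))

  Annihilates : {m : ℕ} → Vec Z m → Z → Set
  Annihilates w y = All (λ a → q ∣ toℕ a * toℕ y) w

  annihilates? : {m : ℕ} (w : Vec Z m) → Decidable (Annihilates w)
  annihilates? w y = All.all? (λ a → q ∣? toℕ a * toℕ y) w

  annihilatorSize : {m : ℕ} → Vec Z m → ℕ
  annihilatorSize w = ∑[ y ∈ allFin q ] 𝟙 (annihilates? w y)

  Divisible : {m : ℕ} → ℕ → Vec Z m → Set
  Divisible d w = All (λ a → d ∣ toℕ a) w

  divisible? : {m : ℕ} (d : ℕ) (w : Vec Z m) → Dec (Divisible d w)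
  divisible? d = All.all? (λ a → d ∣? toℕ a)

  module Shear {m : ℕ} (u : Vec Z (suc m)) (i : Fin (suc m)) (unit : Invertible (lookup u i)) where

    uᵢ : ℕ
    uᵢ = toℕ (lookup u i)

    uᵢ⁻¹ : ℕ
    uᵢ⁻¹ = proj₁ (unit-inverse unit)

    uᵢ⁻¹-inverse : uᵢ⁻¹ * uᵢ ≈ 1
    uᵢ⁻¹-inverse = proj₂ (unit-inverse unit)

    padded : Vec Z m → Vec Z (suc m)
    padded w = insertAt w i 0ᶻ

    toℕ-padded-i : (w : Vec Z m) → toℕ (lookup (padded w) i) ≡ 0
    toℕ-padded-i w = trans (cong toℕ (Vecₚ.insertAt-lookup w i 0ᶻ)) toℕ-0ᶻ

    shear : Z × Vec Z m → Vec Z (suc m)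
    shear (c , w) = tabulate (λ k → reduce (toℕ c * toℕ (lookup u k) + toℕ (lookup (padded w) k)))

    coefficient : Vec Z (suc m) → Z
    coefficient v = reduce (uᵢ⁻¹ * toℕ (lookup v i))

    residual : Vec Z (suc m) → Vec Z (suc m)
    residual v = tabulate (λ k → reduce (toℕ (lookup v k) + neg (toℕ (coefficient v) * toℕ (lookup u k))))

    unshear : Vec Z (suc m) → Z × Vec Z m
    unshear v = coefficient v , removeAt (residual v) i

    toℕ-shear : ∀ c w k →
                toℕ (lookup (shear (c , w)) k) ≈ toℕ c * toℕ (lookup u k) + toℕ (lookup (padded w) k)
    toℕ-shear c w = toℕ-lookup-tabulate-reduce _

    toℕ-shear-i : ∀ c w → toℕ (lookup (shear (c , w)) i) ≈ toℕ c * uᵢ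
    toℕ-shear-i c w = ≈-trans (toℕ-shear c w i)
      (≡⇒≈ (trans (cong (toℕ c * uᵢ +_) (toℕ-padded-i w)) (+-identityʳ _)))

    toℕ-residual : ∀ v k →
                   toℕ (lookup (residual v) k) ≈ toℕ (lookup v k) + neg (toℕ (coefficient v) * toℕ (lookup u k))
    toℕ-residual v = toℕ-lookup-tabulate-reduce _

    coefficient-shear : ∀ c w → coefficient (shear (c , w)) ≡ c
    coefficient-shear c w = toℕ-injective (begin
      toℕ (coefficient (shear (c , w))) ≈⟨ toℕ-reduce _ ⟩
      uᵢ⁻¹ * toℕ (lookup (shear (c , w)) i) ≈⟨ *-cong (≈-refl {uᵢ⁻¹}) (toℕ-shear-i c w) ⟩
      uᵢ⁻¹ * (toℕ c * uᵢ)                   ≡⟨ rearrange uᵢ⁻¹ (toℕ c) uᵢ ⟩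
      toℕ c * (uᵢ⁻¹ * uᵢ)                   ≈⟨ *-cong (≈-refl {toℕ c}) uᵢ⁻¹-inverse ⟩
      toℕ c * 1                             ≡⟨ *-identityʳ (toℕ c) ⟩
      toℕ c                                 ∎)
      where
      open ≈-Reasoning
      rearrange : ∀ a b c → a * (b * c) ≡ b * (a * c)
      rearrange = solve-∀

    unshear-shear : ∀ cw → unshear (shear cw) ≡ cw
    unshear-shear (c , w) = cong₂ _,_ (coefficient-shear c w)
      (trans (cong (λ r → removeAt r i) (pointwise-≈⇒≡ (residual (shear (c , w))) (padded w) residual≈))
             (Vecₚ.removeAt-insertAt w i 0ᶻ))
      where
      open ≈-Reasoning
      residual≈ : ∀ k → toℕ (lookup (residual (shear (c , w))) k) ≈ toℕ (lookup (padded w) k)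
      residual≈ k = let cuₖ = toℕ c * toℕ (lookup u k) in begin
        toℕ (lookup (residual (shear (c , w))) k)             ≈⟨ toℕ-residual (shear (c , w)) k ⟩
        toℕ (lookup (shear (c , w)) k) + neg (toℕ (coefficient (shear (c , w))) * toℕ (lookup u k))
          ≡⟨ cong (λ c′ → toℕ (lookup (shear (c , w)) k) + neg (toℕ c′ * toℕ (lookup u k))) (coefficient-shear c w) ⟩
        toℕ (lookup (shear (c , w)) k) + neg cuₖ              ≈⟨ +-cong (toℕ-shear c w k) ≈-refl ⟩
        cuₖ + toℕ (lookup (padded w) k) + neg cuₖ             ≡⟨ +-assoc cuₖ _ (neg cuₖ) ⟩
        cuₖ + (toℕ (lookup (padded w) k) + neg cuₖ)           ≈⟨ +-neg-cancel cuₖ _ ⟩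
        toℕ (lookup (padded w) k)                             ∎

    shear-unshear : ∀ v → shear (unshear v) ≡ v
    shear-unshear v = pointwise-≈⇒≡ (shear (unshear v)) v shear≈
      where
      open ≈-Reasoning
      c : Z
      c = coefficient v
      r : Vec Z (suc m)
      r = residual v
      cuᵢ≈vᵢ : toℕ c * uᵢ ≈ toℕ (lookup v i)
      cuᵢ≈vᵢ = begin
        toℕ c * uᵢ                          ≈⟨ *-cong (toℕ-reduce (uᵢ⁻¹ * toℕ (lookup v i))) (≈-refl {uᵢ}) ⟩
        uᵢ⁻¹ * toℕ (lookup v i) * uᵢ        ≡⟨ rearrange uᵢ⁻¹ (toℕ (lookup v i)) uᵢ ⟩
        toℕ (lookup v i) * (uᵢ⁻¹ * uᵢ)      ≈⟨ *-cong (≈-refl {toℕ (lookup v i)}) uᵢ⁻¹-inverse ⟩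
        toℕ (lookup v i) * 1                ≡⟨ *-identityʳ _ ⟩
        toℕ (lookup v i)                    ∎
        where
        rearrange : ∀ a b c → a * b * c ≡ b * (a * c)
        rearrange = solve-∀
      rᵢ≡0 : lookup r i ≡ 0ᶻ
      rᵢ≡0 = toℕ-injective (begin
        toℕ (lookup r i)                         ≈⟨ toℕ-residual v i ⟩
        toℕ (lookup v i) + neg (toℕ c * uᵢ)      ≡⟨ cong (toℕ (lookup v i) +_) (neg-cong cuᵢ≈vᵢ) ⟩
        toℕ (lookup v i) + neg (toℕ (lookup v i)) ≈⟨ +-inverseʳ _ ⟩
        0                                        ≡⟨ toℕ-0ᶻ ⟨
        toℕ 0ᶻ                                   ∎)
      padded-r : padded (removeAt r i) ≡ r
      padded-r = trans (cong (insertAt (removeAt r i) i) (sym rᵢ≡0)) (Vecₚ.insertAt-removeAt r i)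
      shear≈ : ∀ k → toℕ (lookup (shear (c , removeAt r i)) k) ≈ toℕ (lookup v k)
      shear≈ k = let cuₖ = toℕ c * toℕ (lookup u k) in begin
        toℕ (lookup (shear (c , removeAt r i)) k)     ≈⟨ toℕ-shear c _ k ⟩
        cuₖ + toℕ (lookup (padded (removeAt r i)) k)  ≡⟨ cong (λ x → cuₖ + toℕ (lookup x k)) padded-r ⟩
        cuₖ + toℕ (lookup r k)                        ≈⟨ +-cong (≈-refl {cuₖ}) (toℕ-residual v k) ⟩
        cuₖ + (toℕ (lookup v k) + neg cuₖ)            ≈⟨ +-neg-cancel cuₖ _ ⟩
        toℕ (lookup v k)                              ∎

    shear↔ : (Z × Vec Z m) ↔ Vec Z (suc m)
    shear↔ = mk↔ₛ′ shear unshear shear-unshear unshear-shear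

    shear-row : ∀ c w (x₁ x₂ : Z) k →
      toℕ (lookup u k) * toℕ x₁ + toℕ (lookup (shear (c , w)) k) * toℕ x₂
        ≈ toℕ (lookup u k) * (toℕ x₁ + toℕ c * toℕ x₂) + toℕ (lookup (padded w) k) * toℕ x₂
    shear-row c w x₁ x₂ k =
      ≈-trans (+-cong (≈-refl {toℕ (lookup u k) * toℕ x₁}) (*-cong (toℕ-shear c w k) (≈-refl {toℕ x₂})))
              (≡⇒≈ (distribute (toℕ (lookup u k)) (toℕ x₁) (toℕ c) (toℕ (lookup (padded w) k)) (toℕ x₂)))
      where
      distribute : ∀ a x c p y → a * x + (c * a + p) * y ≡ a * (x + c * y) + p * y
      distribute = solve-∀

    forced : Z → Z → Z
    forced c x₂ = reduce (neg (toℕ c * toℕ x₂))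

    forced⇔≈0 : ∀ c (x₁ x₂ : Z) → x₁ ≡ forced c x₂ ⇔ toℕ x₁ + toℕ c * toℕ x₂ ≈ 0
    forced⇔≈0 c x₁ x₂ = mk⇔
      (λ x₁≡ → ≈-trans (+-cong (≈-trans (≡⇒≈ (cong toℕ x₁≡)) (toℕ-reduce _)) (≈-refl {toℕ c * toℕ x₂}))
                       (≈-trans (≡⇒≈ (+-comm _ (toℕ c * toℕ x₂))) (+-inverseʳ _)))
      (λ y≈0 → toℕ-injective (≈-trans
        (+-cancelˡ (toℕ c * toℕ x₂) (≈-trans (≡⇒≈ (+-comm _ (toℕ x₁))) (≈-trans y≈0 (≈-sym (+-inverseʳ _)))))
        (≈-sym (toℕ-reduce _))))

    0ᶻ-annihilates : ∀ (y : Z) → q ∣ toℕ 0ᶻ * toℕ y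
    0ᶻ-annihilates y = subst (λ t → q ∣ t * toℕ y) (sym toℕ-0ᶻ) (q ∣0)

    -- In the sheared coordinates the system reads uₖ (x₁ + c x₂) + wₖ x₂ ≡ 0, and the unit uᵢ forces x₁ + c x₂ ≡ 0.
    solves-shear : ∀ c w (x₁ x₂ : Z) → Solves u (shear (c , w)) x₁ x₂ ⇔ (x₁ ≡ forced c x₂ × Annihilates w x₂)
    solves-shear c w x₁ x₂ = mk⇔ to from
      where
      y : ℕ
      y = toℕ x₁ + toℕ c * toℕ x₂
      to : Solves u (shear (c , w)) x₁ x₂ → x₁ ≡ forced c x₂ × Annihilates w x₂
      to s = Equivalence.from (forced⇔≈0 c x₁ x₂) y≈0
           , All-insertAt⁻ w i (lookup⁻ (λ k → ≈0⇒∣ (+≈0⇒≈0 (*-zeroʳ-≈ (toℕ (lookup u k)) y≈0) (row k))))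
        where
        row : ∀ k → toℕ (lookup u k) * y + toℕ (lookup (padded w) k) * toℕ x₂ ≈ 0
        row k = ≈-trans (≈-sym (shear-row c w x₁ x₂ k)) (∣⇒≈0 (s k))
        uᵢy≈0 : uᵢ * y ≈ 0
        uᵢy≈0 = ≈-trans (≡⇒≈ (sym (trans (cong (λ t → uᵢ * y + t * toℕ x₂) (toℕ-padded-i w)) (+-identityʳ _)))) (row i)
        y≈0 : y ≈ 0
        y≈0 = ∣⇒≈0 (coprime-divisor (Coprimality.sym unit) (≈0⇒∣ uᵢy≈0))
      from : x₁ ≡ forced c x₂ × Annihilates w x₂ → Solves u (shear (c , w)) x₁ x₂
      from (x₁≡ , ann) k = ≈0⇒∣ (≈-trans (shear-row c w x₁ x₂ k)
        (+-cong (*-zeroʳ-≈ (toℕ (lookup u k)) (Equivalence.to (forced⇔≈0 c x₁ x₂) x₁≡))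
                (∣⇒≈0 (lookup⁺ (All-insertAt⁺ w i (0ᶻ-annihilates x₂) ann) k))))

    solutionCount-shear : ∀ c w → solutionCount u (shear (c , w)) ≡ annihilatorSize w
    solutionCount-shear c w = solutionCount-graph u (shear (c , w)) (forced c) (annihilates? w) (solves-shear c w)

    divisible-shear : ∀ {d} → d ∣ q → ∀ c w → Divisible d (shear (c , w)) ⇔ (d ∣ toℕ c × Divisible d w)
    divisible-shear {d} d∣q c w = mk⇔ to from
      where
      d∣entry : ∀ {k} → d ∣ toℕ (lookup (shear (c , w)) k) → d ∣ toℕ c * toℕ (lookup u k) + toℕ (lookup (padded w) k)
      d∣entry {k} = ∣-resp-≈ d∣q (toℕ-shear c w k)
      to : Divisible d (shear (c , w)) → d ∣ toℕ c × Divisible d w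
      to div = d∣c , All-insertAt⁻ w i (lookup⁻ (λ k → ∣m+n∣m⇒∣n (d∣entry (lookup⁺ div k)) (∣m⇒∣m*n _ d∣c)))
        where
        d∣c : d ∣ toℕ c
        d∣c = coprime-divisor (λ (e∣d , e∣uᵢ) → unit (e∣uᵢ , ∣-trans e∣d d∣q))
                (subst (d ∣_) (*-comm (toℕ c) uᵢ) (∣-resp-≈ d∣q (toℕ-shear-i c w) (lookup⁺ div i)))
      from : d ∣ toℕ c × Divisible d w → Divisible d (shear (c , w))
      from (d∣c , div) = lookup⁻ (λ k → ∣-resp-≈ d∣q (≈-sym (toℕ-shear c w k))
        (∣m∣n⇒∣m+n (∣m⇒∣m*n _ d∣c) (lookup⁺ (All-insertAt⁺ w i (subst (d ∣_) (sym toℕ-0ᶻ) (d ∣0)) div) k)))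

  ∑-divisible-solutionCount : {m : ℕ} (u : Vec Z (suc m)) → HasUnit u →
    (e d : ℕ) .{{_ : NonZero d}} → q ≡ e * d → (N : ℕ) →
    ∑[ v ∈ allVectors (suc m) ] (𝟙 (divisible? d v) * 𝟙 (solutionCount u v ≟ N))
      ≡ e * ∑[ w ∈ allVectors m ] (𝟙 (divisible? d w) * 𝟙 (annihilatorSize w ≟ N))
  ∑-divisible-solutionCount {m} u hasUnit e d q≡ed N = begin
    ∑[ v ∈ allVectors (suc m) ] F v
      ≡⟨ ∑-reindex (cartesianProduct-enumeratesOnce (allFin-enumeratesOnce q) (allVectors-enumeratesOnce m))
                   (allVectors-enumeratesOnce (suc m)) shear↔ F ⟩
    ∑ (cartesianProduct (allFin q) (allVectors m)) (F ∘ shear)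
      ≡⟨ ∑-cartesianProduct (allFin q) (allVectors m) _ ⟩
    ∑[ c ∈ allFin q ] ∑[ w ∈ allVectors m ] F (shear (c , w))
      ≡⟨ ∑-cong (allFin q) (λ c → ∑-cong (allVectors m) (λ w → F-shear c w)) ⟩
    ∑[ c ∈ allFin q ] ∑[ w ∈ allVectors m ] (𝟙 (d ∣? toℕ c) * G w)
      ≡⟨ ∑-cong (allFin q) (λ c → ∑-*ˡ (allVectors m) (𝟙 (d ∣? toℕ c)) G) ⟩
    ∑[ c ∈ allFin q ] (𝟙 (d ∣? toℕ c) * ∑ (allVectors m) G)
      ≡⟨ ∑-*ʳ (allFin q) _ _ ⟩
    ∑[ c ∈ allFin q ] 𝟙 (d ∣? toℕ c) * ∑ (allVectors m) G
      ≡⟨ cong (_* ∑ (allVectors m) G) (count-multiples e d q≡ed) ⟩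
    e * ∑ (allVectors m) G ∎
    where
    open ≡-Reasoning
    open Shear u (Any.index hasUnit) (lookup-index hasUnit)
    F : Vec Z (suc m) → ℕ
    F v = 𝟙 (divisible? d v) * 𝟙 (solutionCount u v ≟ N)
    G : Vec Z m → ℕ
    G w = 𝟙 (divisible? d w) * 𝟙 (annihilatorSize w ≟ N)
    F-shear : ∀ c w → F (shear (c , w)) ≡ 𝟙 (d ∣? toℕ c) * G w
    F-shear c w = begin
      𝟙 (divisible? d (shear (c , w))) * 𝟙 (solutionCount u (shear (c , w)) ≟ N)
        ≡⟨ cong₂ _*_ (𝟙-× (d ∣? toℕ c) (divisible? d w) (divisible? d (shear (c , w)))
                          (Equivalence.to div⇔) (λ d∣c dw → Equivalence.from div⇔ (d∣c , dw)))
                     (cong (λ n → 𝟙 (n ≟ N)) (solutionCount-shear c w)) ⟩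
      𝟙 (d ∣? toℕ c) * 𝟙 (divisible? d w) * 𝟙 (annihilatorSize w ≟ N)
        ≡⟨ *-assoc (𝟙 (d ∣? toℕ c)) _ _ ⟩
      𝟙 (d ∣? toℕ c) * G w ∎
      where
      div⇔ : Divisible d (shear (c , w)) ⇔ (d ∣ toℕ c × Divisible d w)
      div⇔ = divisible-shear (divides e q≡ed) c w

-- The modulus p^s

module PrimePowerModulus {p : ℕ} (p-prime : Prime p) {s : ℕ} (1≤s : 1 ≤ s) where

  private instance
    p≢0 : NonZero p
    p≢0 = prime⇒nonZero p-prime

  q : ℕ
  q = p ^ s

  instance
    q≢0 : NonZero q
    q≢0 = m^n≢0 p s

  open TwoColumns q public

  nonunit⇔p∣ : (a : Z) → (¬ Invertible a) ⇔ p ^ 1 ∣ toℕ a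
  nonunit⇔p∣ a = mk⇔
    (λ ¬unit → subst (_∣ toℕ a) (sym (*-identityʳ p)) (Equivalence.to (¬coprime-^⇔∣ p-prime 1≤s) ¬unit))
    (λ p^1∣a → Equivalence.from (¬coprime-^⇔∣ p-prime 1≤s) (subst (_∣ toℕ a) (*-identityʳ p) p^1∣a))

  ¬hasUnit⇔divisible : {n : ℕ} (u : Vec Z n) → (¬ HasUnit u) ⇔ Divisible (p ^ 1) u
  ¬hasUnit⇔divisible u = mk⇔
    (λ ¬hasUnit → All.map (Equivalence.to (nonunit⇔p∣ _)) (¬Any⇒All¬ u ¬hasUnit))
    (λ div → All¬⇒¬Any (All.map (Equivalence.from (nonunit⇔p∣ _)) div))

  𝟙-relPrime : {n : ℕ} (u v : Vec Z n) →
    𝟙 (relPrime? (fromColumns u v)) ≡ 𝟙 (hasUnit? u) + 𝟙 (divisible? (p ^ 1) u) * 𝟙 (hasUnit? v)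
  𝟙-relPrime u v with hasUnit? u
  ... | yes hu = trans (𝟙-yes (hasUnit⇒relPrimeˡ u v hu) _)
                       (cong (λ b → 1 + b * 𝟙 (hasUnit? v)) (sym (𝟙-no (λ div → from (¬hasUnit⇔divisible u) div hu) (divisible? (p ^ 1) u))))
    where open Equivalence
  ... | no ¬hu = begin
    𝟙 (relPrime? (fromColumns u v))
      ≡⟨ 𝟙-⇔ (λ rp → [ (λ hu → ⊥-elim (¬hu hu)) , (λ hv → hv) ] (relPrime⇒hasUnit u v rp)) (hasUnit⇒relPrimeʳ u v) _ _ ⟩
    𝟙 (hasUnit? v)
      ≡⟨ *-identityˡ _ ⟨
    1 * 𝟙 (hasUnit? v)
      ≡⟨ cong (_* 𝟙 (hasUnit? v)) (𝟙-yes (Equivalence.to (¬hasUnit⇔divisible u) ¬hu) (divisible? (p ^ 1) u)) ⟨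
    𝟙 (divisible? (p ^ 1) u) * 𝟙 (hasUnit? v) ∎
    where open ≡-Reasoning

  count-hasUnit : (n : ℕ) → ∑[ u ∈ allVectors n ] 𝟙 (hasUnit? u) ≡ phi n q
  count-hasUnit n = +-cancelʳ-≡ _ _ _ (begin
    ∑[ u ∈ allVectors n ] 𝟙 (hasUnit? u) + (p ^ (s ∸ 1)) ^ n
      ≡⟨ cong (λ X → ∑[ u ∈ allVectors n ] 𝟙 (hasUnit? u) + X ^ n) (count-nonunits p-prime 1≤s) ⟨
    ∑[ u ∈ allVectors n ] 𝟙 (hasUnit? u) + (∑[ a ∈ allFin q ] 𝟙 (¬? (coprime? (toℕ a) q))) ^ n
      ≡⟨ ∑-vectors-any (allFin q) _ n ⟩
    length (allFin q) ^ n                         ≡⟨ cong (_^ n) (length-allFin q) ⟩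
    q ^ n                                         ≡⟨ phi-prime-power p-prime n 1≤s ⟨
    phi n q + (p ^ (s ∸ 1)) ^ n                   ∎)
    where open ≡-Reasoning

  ∑-hasUnit : {n : ℕ} (f : Vec Z n → ℕ) (K : ℕ) → (∀ u → HasUnit u → f u ≡ K) →
              ∑[ u ∈ allVectors n ] (𝟙 (hasUnit? u) * f u) ≡ phi n q * K
  ∑-hasUnit {n} f K f≡K = begin
    ∑[ u ∈ allVectors n ] (𝟙 (hasUnit? u) * f u) ≡⟨ ∑-cong (allVectors n) on-units ⟩
    ∑[ u ∈ allVectors n ] (𝟙 (hasUnit? u) * K)   ≡⟨ ∑-*ʳ (allVectors n) K _ ⟩
    ∑[ u ∈ allVectors n ] 𝟙 (hasUnit? u) * K     ≡⟨ cong (_* K) (count-hasUnit n) ⟩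
    phi n q * K                                  ∎
    where
    open ≡-Reasoning
    on-units : ∀ u → 𝟙 (hasUnit? u) * f u ≡ 𝟙 (hasUnit? u) * K
    on-units u with hasUnit? u
    ... | yes hu = cong (1 *_) (f≡K u hu)
    ... | no _   = refl

  divisible-weaken : {m : ℕ} {k j : ℕ} → k ≤ j → (w : Vec Z m) → Divisible (p ^ j) w → Divisible (p ^ k) w
  divisible-weaken {k = k} {j} k≤j w = All.map (∣-trans (divides (p ^ (j ∸ k)) (p^-split p-prime k≤j)))

  ExactLevel : {m : ℕ} → ℕ → Vec Z m → Set
  ExactLevel j w = Divisible (p ^ j) w × (j < s → ¬ Divisible (p ^ suc j) w)

  exactLevel? : {m : ℕ} (j : ℕ) (w : Vec Z m) → Dec (ExactLevel j w)
  exactLevel? j w = divisible? (p ^ j) w ×-dec ((j <? s) →-dec ¬? (divisible? (p ^ suc j) w))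

  -- If p^j exactly divides the entries of w, some entry is p^j times a unit, which annihilates y iff p^(s-j) ∣ y.
  annihilates⇔ : {m : ℕ} {w : Vec Z m} {j : ℕ} → j ≤ s → ExactLevel j w →
                 (y : Z) → Annihilates w y ⇔ p ^ (s ∸ j) ∣ toℕ y
  annihilates⇔ {w = w} {j} j≤s (div , top) y = mk⇔ to from
    where
    q≡p^j*p^[s∸j] : q ≡ p ^ j * p ^ (s ∸ j)
    q≡p^j*p^[s∸j] = trans (p^-split p-prime j≤s) (*-comm (p ^ (s ∸ j)) (p ^ j))
    from : p ^ (s ∸ j) ∣ toℕ y → Annihilates w y
    from p^[s∸j]∣y = lookup⁻ (λ k →
      subst (_∣ toℕ (lookup w k) * toℕ y) (sym q≡p^j*p^[s∸j]) (*-pres-∣ (lookup⁺ div k) p^[s∸j]∣y))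
    unit-entry : ∀ k → ¬ p ^ suc j ∣ toℕ (lookup w k) → p ^ j ∣ toℕ (lookup w k) →
                 Annihilates w y → p ^ (s ∸ j) ∣ toℕ y
    unit-entry k p^[1+j]∤wₖ (divides t wₖ≡t*p^j) ann =
      coprime-divisor (Coprimality.sym (¬∣⇒coprime-^ p-prime p∤t (s ∸ j))) p^[s∸j]∣ty
      where
      p∤t : ¬ p ∣ t
      p∤t (divides t′ t≡t′*p) =
        p^[1+j]∤wₖ (divides t′ (trans wₖ≡t*p^j (trans (cong (_* p ^ j) t≡t′*p) (*-assoc t′ p (p ^ j)))))
      rearrange : ∀ a b c → a * b * c ≡ b * (a * c)
      rearrange = solve-∀
      p^[s∸j]∣ty : p ^ (s ∸ j) ∣ t * toℕ y
      p^[s∸j]∣ty = *-cancelˡ-∣ (p ^ j) {{m^n≢0 p j}}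
        (subst₂ _∣_ q≡p^j*p^[s∸j] (trans (cong (_* toℕ y) wₖ≡t*p^j) (rearrange t (p ^ j) (toℕ y))) (lookup⁺ ann k))
    to : Annihilates w y → p ^ (s ∸ j) ∣ toℕ y
    to ann with m≤n⇒m<n∨m≡n j≤s
    ... | inj₂ refl = subst (λ t → p ^ t ∣ toℕ y) (sym (n∸n≡0 s)) (1∣ toℕ y)
    ... | inj₁ j<s  = unit-entry (Any.index ¬div) (lookup-index ¬div) (lookup⁺ div (Any.index ¬div)) ann
      where
      ¬div : Any (λ a → ¬ p ^ suc j ∣ toℕ a) w
      ¬div = ¬All⇒Any¬ (λ a → p ^ suc j ∣? toℕ a) w (top j<s)

  annihilatorSize-exactLevel : {m : ℕ} {w : Vec Z m} {j : ℕ} → j ≤ s → ExactLevel j w → annihilatorSize w ≡ p ^ j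
  annihilatorSize-exactLevel {w = w} {j} j≤s exact = trans
    (∑-cong (allFin q) (λ y → 𝟙-⇔ (Equivalence.to (annihilates⇔ j≤s exact y)) (Equivalence.from (annihilates⇔ j≤s exact y))
                                   (annihilates? w y) (p ^ (s ∸ j) ∣? toℕ y)))
    (count-multiples (p ^ j) (p ^ (s ∸ j)) {{m^n≢0 p (s ∸ j)}} (trans (p^-split p-prime j≤s) (*-comm (p ^ (s ∸ j)) (p ^ j))))

  exactLevel-exists : {m : ℕ} (w : Vec Z m) → Σ ℕ (λ j → j ≤ s × ExactLevel j w)
  exactLevel-exists w = search s 0 (+-identityʳ s) (All.universal (λ a → 1∣ toℕ a) w)
    where
    search : (t j : ℕ) → t + j ≡ s → Divisible (p ^ j) w → Σ ℕ (λ j → j ≤ s × ExactLevel j w)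
    search zero    j refl div = j , ≤-refl , div , λ j<j → ⊥-elim (<-irrefl refl j<j)
    search (suc t) j t+j≡s div with divisible? (p ^ suc j) w
    ... | yes div′ = search t (suc j) (trans (+-suc t j) t+j≡s) div′
    ... | no ¬div′ = j , subst (j ≤_) t+j≡s (m≤n+m j (suc t)) , div , λ _ → ¬div′

  annihilatorSize≡p^⇒exactLevel : {m : ℕ} (w : Vec Z m) {j : ℕ} → annihilatorSize w ≡ p ^ j → j ≤ s × ExactLevel j w
  annihilatorSize≡p^⇒exactLevel w {j} size≡p^j with exactLevel-exists w
  ... | l , l≤s , exact with p^-injective p-prime {l} {j} (trans (sym (annihilatorSize-exactLevel l≤s exact)) size≡p^j)
  ... | refl = l≤s , exact

  count-divisible : (m : ℕ) {j : ℕ} → j ≤ s → ∑[ w ∈ allVectors m ] 𝟙 (divisible? (p ^ j) w) ≡ (p ^ (s ∸ j)) ^ m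
  count-divisible m {j} j≤s = trans (∑-vectors-all (allFin q) (λ a → p ^ j ∣? toℕ a) m)
    (cong (_^ m) (count-multiples (p ^ (s ∸ j)) (p ^ j) {{m^n≢0 p j}} (p^-split p-prime j≤s)))

  count-exactLevel : (m : ℕ) {j : ℕ} → j ≤ s → ∑[ w ∈ allVectors (suc m) ] 𝟙 (exactLevel? j w) ≡ phi (suc m) (p ^ (s ∸ j))
  count-exactLevel m {j} j≤s with m≤n⇒m<n∨m≡n j≤s
  ... | inj₂ refl = begin
    ∑[ w ∈ allVectors (suc m) ] 𝟙 (exactLevel? s w)  ≡⟨ ∑-cong (allVectors (suc m)) (λ w →
                                                          𝟙-⇔ proj₁ (λ div → div , λ s<s → ⊥-elim (<-irrefl refl s<s)) _ _) ⟩
    ∑[ w ∈ allVectors (suc m) ] 𝟙 (divisible? (p ^ s) w) ≡⟨ count-divisible (suc m) ≤-refl ⟩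
    (p ^ (s ∸ s)) ^ suc m                            ≡⟨ cong (λ t → (p ^ t) ^ suc m) (n∸n≡0 s) ⟩
    1 ^ suc m                                        ≡⟨ ^-zeroˡ (suc m) ⟩
    1                                                ≡⟨ phi[1+m,1]≡1 m ⟨
    phi (suc m) 1                                    ≡⟨ cong (λ t → phi (suc m) (p ^ t)) (n∸n≡0 s) ⟨
    phi (suc m) (p ^ (s ∸ s))                        ∎
    where open ≡-Reasoning
  ... | inj₁ j<s = +-cancelʳ-≡ _ _ _ (begin
    #exact + (p ^ (s ∸ j ∸ 1)) ^ suc m             ≡⟨ cong (λ t → #exact + (p ^ t) ^ suc m) (pred[m∸n]≡m∸[1+n] s j) ⟩
    #exact + (p ^ (s ∸ suc j)) ^ suc m             ≡⟨ cong (#exact +_) (count-divisible (suc m) j<s) ⟨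
    #exact + ∑[ w ∈ allVectors (suc m) ] 𝟙 (divisible? (p ^ suc j) w) ≡⟨ ∑-+ (allVectors (suc m)) _ _ ⟨
    ∑[ w ∈ allVectors (suc m) ] (𝟙 (exactLevel? j w) + 𝟙 (divisible? (p ^ suc j) w))
                                                   ≡⟨ ∑-cong (allVectors (suc m)) split ⟨
    ∑[ w ∈ allVectors (suc m) ] 𝟙 (divisible? (p ^ j) w) ≡⟨ count-divisible (suc m) j≤s ⟩
    (p ^ (s ∸ j)) ^ suc m                          ≡⟨ phi-prime-power p-prime (suc m) (m<n⇒0<n∸m j<s) ⟨
    phi (suc m) (p ^ (s ∸ j)) + (p ^ (s ∸ j ∸ 1)) ^ suc m ∎)
    where
    open ≡-Reasoning
    #exact : ℕ
    #exact = ∑[ w ∈ allVectors (suc m) ] 𝟙 (exactLevel? j w)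
    split : ∀ w → 𝟙 (divisible? (p ^ j) w) ≡ 𝟙 (exactLevel? j w) + 𝟙 (divisible? (p ^ suc j) w)
    split w with divisible? (p ^ suc j) w
    ... | yes div′ = trans (𝟙-yes (divisible-weaken (n≤1+n j) w div′) _) (cong (_+ 1) (sym (𝟙-no (λ (_ , top) → top j<s div′) _)))
    ... | no ¬div′ = trans (𝟙-⇔ (λ div → div , λ _ → ¬div′) proj₁ _ _) (sym (+-identityʳ _))

  annihilatorCount : (m k N : ℕ) → ℕ
  annihilatorCount m k N = ∑[ w ∈ allVectors m ] (𝟙 (divisible? (p ^ k) w) * 𝟙 (annihilatorSize w ≟ N))

  annihilatorCount-≤ : (m : ℕ) {k j : ℕ} → k ≤ j → j ≤ s → annihilatorCount (suc m) k (p ^ j) ≡ phi (suc m) (p ^ (s ∸ j))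
  annihilatorCount-≤ m {k} {j} k≤j j≤s = trans (∑-cong (allVectors (suc m)) exactly) (count-exactLevel m j≤s)
    where
    exactly : ∀ w → 𝟙 (divisible? (p ^ k) w) * 𝟙 (annihilatorSize w ≟ p ^ j) ≡ 𝟙 (exactLevel? j w)
    exactly w = sym (𝟙-× (divisible? (p ^ k) w) (annihilatorSize w ≟ p ^ j) (exactLevel? j w)
      (λ exact → divisible-weaken k≤j w (proj₁ exact) , annihilatorSize-exactLevel j≤s exact)
      (λ _ size≡p^j → proj₂ (annihilatorSize≡p^⇒exactLevel w size≡p^j)))

  annihilatorCount-< : (m : ℕ) {k j : ℕ} → j < k → k ≤ s → annihilatorCount m k (p ^ j) ≡ 0
  annihilatorCount-< m {k} {j} j<k k≤s = trans (∑-cong (allVectors m) none) (∑-zero (allVectors m))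
    where
    none : ∀ w → 𝟙 (divisible? (p ^ k) w) * 𝟙 (annihilatorSize w ≟ p ^ j) ≡ 0
    none w = sym (𝟙-× (divisible? (p ^ k) w) (annihilatorSize w ≟ p ^ j) (no (λ ())) (λ ())
      (λ div size≡p^j → proj₂ (proj₂ (annihilatorSize≡p^⇒exactLevel w size≡p^j))
                                (<-≤-trans j<k k≤s) (divisible-weaken j<k w div)))

  annihilatorCount-> : (m k : ℕ) {j : ℕ} → s < j → annihilatorCount m k (p ^ j) ≡ 0
  annihilatorCount-> m k {j} s<j = trans (∑-cong (allVectors m) none) (∑-zero (allVectors m))
    where
    none : ∀ w → 𝟙 (divisible? (p ^ k) w) * 𝟙 (annihilatorSize w ≟ p ^ j) ≡ 0
    none w = sym (𝟙-× (divisible? (p ^ k) w) (annihilatorSize w ≟ p ^ j) (no (λ ())) (λ ())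
      (λ _ size≡p^j → <⇒≱ s<j (proj₁ (annihilatorSize≡p^⇒exactLevel w size≡p^j))))

  ∑-solutionCount-unitˡ : {n : ℕ} (u : Vec Z (suc n)) → HasUnit u → (N : ℕ) →
    ∑[ v ∈ allVectors (suc n) ] 𝟙 (solutionCount u v ≟ N) ≡ q * annihilatorCount n 0 N
  ∑-solutionCount-unitˡ {n} u hu N = trans
    (∑-cong (allVectors (suc n)) (λ v → sym (trans (cong (_* X v) (𝟙-yes (All.universal (λ a → 1∣ toℕ a) v) (divisible? 1 v)))
                                                   (*-identityˡ (X v)))))
    (∑-divisible-solutionCount u hu q (p ^ 0) (sym (*-identityʳ q)) N)
    where
    X : Vec Z (suc n) → ℕ
    X v = 𝟙 (solutionCount u v ≟ N)

  ∑-solutionCount-unitʳ : {n : ℕ} (v : Vec Z (suc n)) → HasUnit v → (N : ℕ) →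
    ∑[ u ∈ allVectors (suc n) ] (𝟙 (divisible? (p ^ 1) u) * 𝟙 (solutionCount u v ≟ N)) ≡ p ^ (s ∸ 1) * annihilatorCount n 1 N
  ∑-solutionCount-unitʳ {n} v hv N = trans
    (∑-cong (allVectors (suc n)) (λ u → cong (λ c → 𝟙 (divisible? (p ^ 1) u) * 𝟙 (c ≟ N)) (solutionCount-swap u v)))
    (∑-divisible-solutionCount v hv (p ^ (s ∸ 1)) (p ^ 1) {{m^n≢0 p 1}} (p^-split p-prime 1≤s) N)

  Etilde-decomposition : (n N : ℕ) → Etilde (suc n) 2 q N ≡
    phi (suc n) q * (q * annihilatorCount n 0 N + p ^ (s ∸ 1) * annihilatorCount n 1 N)
  Etilde-decomposition n N = begin
    Etilde (suc n) 2 q N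
      ≡⟨ Etilde-columns (suc n) N ⟩
    ∑[ u ∈ V ] ∑[ v ∈ V ] (𝟙 (relPrime? (fromColumns u v)) * X u v)
      ≡⟨ ∑-cong V (λ u → trans (∑-cong V (λ v → split u v)) (∑-+ V _ _)) ⟩
    ∑[ u ∈ V ] (∑[ v ∈ V ] (𝟙 (hasUnit? u) * X u v) + ∑[ v ∈ V ] (𝟙 (divisible? (p ^ 1) u) * (𝟙 (hasUnit? v) * X u v)))
      ≡⟨ ∑-+ V _ _ ⟩
    ∑[ u ∈ V ] ∑[ v ∈ V ] (𝟙 (hasUnit? u) * X u v) + ∑[ u ∈ V ] ∑[ v ∈ V ] (𝟙 (divisible? (p ^ 1) u) * (𝟙 (hasUnit? v) * X u v))
      ≡⟨ cong₂ _+_ unit-first-column unit-second-column ⟩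
    phi (suc n) q * (q * annihilatorCount n 0 N) + phi (suc n) q * (p ^ (s ∸ 1) * annihilatorCount n 1 N)
      ≡⟨ *-distribˡ-+ (phi (suc n) q) _ _ ⟨
    phi (suc n) q * (q * annihilatorCount n 0 N + p ^ (s ∸ 1) * annihilatorCount n 1 N) ∎
    where
    open ≡-Reasoning
    V : List (Vec Z (suc n))
    V = allVectors (suc n)
    X : Vec Z (suc n) → Vec Z (suc n) → ℕ
    X u v = 𝟙 (solutionCount u v ≟ N)
    exchange : ∀ a b c → a * (b * c) ≡ b * (a * c)
    exchange = solve-∀
    split : ∀ u v → 𝟙 (relPrime? (fromColumns u v)) * X u v
                  ≡ 𝟙 (hasUnit? u) * X u v + 𝟙 (divisible? (p ^ 1) u) * (𝟙 (hasUnit? v) * X u v)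
    split u v = trans (cong (_* X u v) (𝟙-relPrime u v))
                      (trans (*-distribʳ-+ (X u v) (𝟙 (hasUnit? u)) _)
                             (cong (𝟙 (hasUnit? u) * X u v +_) (*-assoc (𝟙 (divisible? (p ^ 1) u)) (𝟙 (hasUnit? v)) (X u v))))
    unit-first-column : ∑[ u ∈ V ] ∑[ v ∈ V ] (𝟙 (hasUnit? u) * X u v) ≡ phi (suc n) q * (q * annihilatorCount n 0 N)
    unit-first-column =
      trans (∑-cong V (λ u → ∑-*ˡ V (𝟙 (hasUnit? u)) (X u)))
            (∑-hasUnit (λ u → ∑ V (X u)) _ (λ u hu → ∑-solutionCount-unitˡ u hu N))
    unit-second-column : ∑[ u ∈ V ] ∑[ v ∈ V ] (𝟙 (divisible? (p ^ 1) u) * (𝟙 (hasUnit? v) * X u v))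
                         ≡ phi (suc n) q * (p ^ (s ∸ 1) * annihilatorCount n 1 N)
    unit-second-column = begin
      ∑[ u ∈ V ] ∑[ v ∈ V ] (𝟙 (divisible? (p ^ 1) u) * (𝟙 (hasUnit? v) * X u v))  ≡⟨ ∑-swap V V _ ⟩
      ∑[ v ∈ V ] ∑[ u ∈ V ] (𝟙 (divisible? (p ^ 1) u) * (𝟙 (hasUnit? v) * X u v))
        ≡⟨ ∑-cong V (λ v → trans (∑-cong V (λ u → exchange (𝟙 (divisible? (p ^ 1) u)) (𝟙 (hasUnit? v)) (X u v)))
                                 (∑-*ˡ V (𝟙 (hasUnit? v)) _)) ⟩
      ∑[ v ∈ V ] (𝟙 (hasUnit? v) * ∑[ u ∈ V ] (𝟙 (divisible? (p ^ 1) u) * X u v))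
        ≡⟨ ∑-hasUnit (λ v → ∑[ u ∈ V ] (𝟙 (divisible? (p ^ 1) u) * X u v)) _ (λ v hv → ∑-solutionCount-unitʳ v hv N) ⟩
      phi (suc n) q * (p ^ (s ∸ 1) * annihilatorCount n 1 N) ∎

  Etilde-kernel-trivial : (m : ℕ) → Etilde (2 + m) 2 q (p ^ 0) ≡ phi (2 + m) q * phi (suc m) q * q
  Etilde-kernel-trivial m = begin
    Etilde (2 + m) 2 q (p ^ 0)                                ≡⟨ Etilde-decomposition (suc m) (p ^ 0) ⟩
    Φ * (q * count 0 (p ^ 0) + p ^ (s ∸ 1) * count 1 (p ^ 0)) ≡⟨ cong₂ (λ a b → Φ * (q * a + p ^ (s ∸ 1) * b))
                                                                   (annihilatorCount-≤ m z≤n z≤n)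
                                                                   (annihilatorCount-< (suc m) (s≤s z≤n) 1≤s) ⟩
    Φ * (q * phi (suc m) q + p ^ (s ∸ 1) * 0)                 ≡⟨ arrange Φ q (phi (suc m) q) (p ^ (s ∸ 1)) ⟩
    Φ * phi (suc m) q * q                                     ∎
    where
    open ≡-Reasoning
    Φ : ℕ
    Φ = phi (2 + m) q
    count : ℕ → ℕ → ℕ
    count = annihilatorCount (suc m)
    arrange : ∀ a b c d → a * (b * c + d * 0) ≡ a * c * b
    arrange = solve-∀

  Etilde-kernel-p^ : (m j : ℕ) → 1 ≤ j → j ≤ s →
    Etilde (2 + m) 2 q (p ^ j) ≡ phi (2 + m) q * phi (suc m) (p ^ (s ∸ j)) * (q + p ^ (s ∸ 1))
  Etilde-kernel-p^ m j 1≤j j≤s = begin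
    Etilde (2 + m) 2 q (p ^ j)                                ≡⟨ Etilde-decomposition (suc m) (p ^ j) ⟩
    Φ * (q * count 0 (p ^ j) + p ^ (s ∸ 1) * count 1 (p ^ j)) ≡⟨ cong₂ (λ a b → Φ * (q * a + p ^ (s ∸ 1) * b))
                                                                   (annihilatorCount-≤ m z≤n j≤s) (annihilatorCount-≤ m 1≤j j≤s) ⟩
    Φ * (q * X + p ^ (s ∸ 1) * X)                             ≡⟨ arrange Φ q X (p ^ (s ∸ 1)) ⟩
    Φ * X * (q + p ^ (s ∸ 1))                                 ∎
    where
    open ≡-Reasoning
    Φ X : ℕ
    Φ = phi (2 + m) q
    X = phi (suc m) (p ^ (s ∸ j))
    count : ℕ → ℕ → ℕ
    count = annihilatorCount (suc m)
    arrange : ∀ a b c d → a * (b * c + d * c) ≡ a * c * (b + d)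
    arrange = solve-∀

  Etilde-kernel-oversized : (m j : ℕ) → s < j → Etilde (2 + m) 2 q (p ^ j) ≡ 0
  Etilde-kernel-oversized m j s<j = begin
    Etilde (2 + m) 2 q (p ^ j)                                ≡⟨ Etilde-decomposition (suc m) (p ^ j) ⟩
    Φ * (q * count 0 (p ^ j) + p ^ (s ∸ 1) * count 1 (p ^ j)) ≡⟨ cong₂ (λ a b → Φ * (q * a + p ^ (s ∸ 1) * b))
                                                                   (annihilatorCount-> (suc m) 0 s<j)
                                                                   (annihilatorCount-> (suc m) 1 s<j) ⟩
    Φ * (q * 0 + p ^ (s ∸ 1) * 0)                             ≡⟨ arrange Φ q (p ^ (s ∸ 1)) ⟩
    0                                                         ∎
    where
    open ≡-Reasoning
    Φ : ℕ
    Φ = phi (2 + m) q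
    count : ℕ → ℕ → ℕ
    count = annihilatorCount (suc m)
    arrange : ∀ a b c → a * (b * 0 + c * 0) ≡ 0
    arrange = solve-∀

proposition4p2 : (p s n : ℕ) → Prime p → 1 ≤ s → 2 ≤ n →
    ((Etilde n 2 (p ^ s) (p ^ 0) ≡ phi n (p ^ s) * phi (n ∸ 1) (p ^ s) * p ^ s)
    × (∀ (j : ℕ) → 1 ≤ j → j ≤ s →
        Etilde n 2 (p ^ s) (p ^ j)
          ≡ phi n (p ^ s) * phi (n ∸ 1) (p ^ (s ∸ j)) * (p ^ s + p ^ (s ∸ 1)))
    × (∀ (j : ℕ) → s < j → Etilde n 2 (p ^ s) (p ^ j) ≡ 0))
proposition4p2 p s (suc (suc m)) p-prime 1≤s (s≤s (s≤s z≤n)) =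
  Etilde-kernel-trivial m , Etilde-kernel-p^ m , Etilde-kernel-oversized m
  where open PrimePowerModulus p-prime 1≤s
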